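{- Let $\theta:k[z_1,\dots,z_{10},a,a^{ -1},b,b^{ -1}]\to k[x_1,x_2,x_3,\alpha,\alpha^{ -1},\beta,\beta^{ -1}]$ be the $k$-algebra homomorphism given by $a^{\pm1}\mapsto\alpha^{\pm3}$, $b^{\pm1}\mapsto\beta^{\pm3}$, and $z_1\mapsto x_1^3+x_2^3+x_3^3$, $z_2\mapsto\alpha^2(\zeta^2x_1^3+\zeta x_2^3+x_3^3)$, $z_3\mapsto\alpha(\zeta x_1^3+\zeta^2x_2^3+x_3^3)$, $z_4\mapsto\beta^2(x_1^2x_3+x_2^2x_1+x_3^2x_2)$, $z_5\mapsto\alpha^2\beta^2(\zeta^2x_1^2x_3+\zeta x_2^2x_1+x_3^2x_2)$, $z_6\mapsto\alpha\beta^2(\zeta x_1^2x_3+\zeta^2x_2^2x_1+x_3^2x_2)$, $z_7\mapsto\beta(x_1^2x_2+x_2^2x_3+x_3^2x_1)$, $z_8\mapsto\alpha^2\beta(\zeta^2x_1^2x_2+\zeta x_2^2x_3+x_3^2x_1)$, $z_9\mapsto\alpha\beta(\zeta x_1^2x_2+\zeta^2x_2^2x_3+x_3^2x_1)$, $z_{10}\mapsto x_1x_2x_3$. Then the image of $\theta$ equals the ring of invariants $k[x_1,x_2,x_3,\alpha,\alpha^{ -1},\beta,\beta^{ -1}]^H$.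
   Context: $k$ is a number field containing a primitive cube root of unity $\zeta$. $H$ is the mod 3 Heisenberg group of upper triangular $3\times3$ matrices over $\mathbb{Z}/3$ with diagonal entries $1$; $E_{12},E_{23},E_{13}$ denote the elements whose only nonzero off-diagonal entry is a $1$ in position $(1,2)$, $(2,3)$, $(1,3)$ respectively. $H$ acts on $k[x_1,x_2,x_3,\alpha^{\pm1},\beta^{\pm1}]$ by $k$-algebra automorphisms determined by: $E_{13}$ sends $x_i\mapsto\zeta x_i$ and fixes $\alpha,\beta$; $E_{12}$ sends $x_1\mapsto x_2\mapsto x_3\mapsto x_1$, $\alpha\mapsto\zeta\alpha$, $\beta\mapsto\beta$; $E_{23}$ sends $x_1\mapsto x_1$, $x_2\mapsto\zeta^2x_2$, $x_3\mapsto\zeta x_3$, $\alpha\mapsto\alpha$, $\beta\mapsto\zeta\beta$. The invariant ring consists of the elements fixed by every $g\in H$. -}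

module Defs where

open import Level using (Level; _⊔_)
open import Data.Nat as ℕ using (ℕ; zero; suc)
open import Data.Integer as ℤ using (ℤ; +_; -[1+_])
open import Data.Fin using (Fin; toℕ)
open import Data.Vec using (Vec; []; _∷_; lookup; zipWith; replicate)
import Data.Vec.Properties as VecP
open import Data.List using (List; []; _∷_; map; concatMap; foldr)
open import Data.Product using (_×_; _,_; Σ; ∃)
open import Data.Product.Properties using (≡-dec)
open import Relation.Nullary using (¬_; yes; no)
open import Relation.Binary.PropositionalEquality using (_≡_)
open import Algebra.Bundles using (CommutativeRing)
open import Algebra.Morphism.Structures using (module RingMorphisms)
open import Data.Rational as ℚ using (ℚ)
import Data.Rational.Properties as ℚP

IsField : ∀ {c ℓ} → CommutativeRing c ℓ → Set (c ⊔ ℓ)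
IsField R = (¬ (1# ≈ 0#)) × (∀ x → ¬ (x ≈ 0#) → Σ Carrier λ y → x * y ≈ 1#)
  where open CommutativeRing R

module _ {c ℓ} (R : CommutativeRing c ℓ) where
  open CommutativeRing R
  ΣFin : (n : ℕ) → (Fin n → Carrier) → Carrier
  ΣFin zero    f = 0#
  ΣFin (suc n) f = f Data.Fin.zero + ΣFin n (λ i → f (Data.Fin.suc i))

IsNumberField : ∀ {c ℓ} → CommutativeRing c ℓ → Set (c ⊔ ℓ)
IsNumberField R =
  IsField R ×
  Σ (ℚ → Carrier) λ φ →
    RingMorphisms.IsRingHomomorphism (CommutativeRing.rawRing ℚP.+-*-commutativeRing) rawRing φ ×
    Σ ℕ λ n → Σ (Fin n → Carrier) λ e →
      ∀ x → Σ (Fin n → ℚ) λ q → x ≈ ΣFin R n (λ i → φ (q i) * e i)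
  where open CommutativeRing R

IsPrimitiveCubeRoot : ∀ {c ℓ} (R : CommutativeRing c ℓ) → CommutativeRing.Carrier R → Set ℓ
IsPrimitiveCubeRoot R ζ = (ζ * ζ * ζ ≈ 1#) × ¬ (ζ ≈ 1#)
  where open CommutativeRing R

-- Laurent polynomials, represented as finite lists of terms
-- (coefficient , monomial); two such lists are equal as polynomials when
-- all their coefficients agree.

-- Monomials x₁^e₁ x₂^e₂ x₃^e₃ α^a β^b  (eᵢ ∈ ℕ, a b ∈ ℤ)
XMon : Set
XMon = ℕ × ℕ × ℕ × ℤ × ℤ

_≟X_ : (m n : XMon) → Relation.Nullary.Dec (m ≡ n)
_≟X_ = ≡-dec ℕ._≟_ (≡-dec ℕ._≟_ (≡-dec ℕ._≟_ (≡-dec ℤ._≟_ ℤ._≟_)))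

_·X_ : XMon → XMon → XMon
(e₁ , e₂ , e₃ , a , b) ·X (f₁ , f₂ , f₃ , a' , b') =
  (e₁ ℕ.+ f₁ , e₂ ℕ.+ f₂ , e₃ ℕ.+ f₃ , a ℤ.+ a' , b ℤ.+ b')

X1 : XMon
X1 = (0 , 0 , 0 , + 0 , + 0)

-- Monomials z₁^e₁ ⋯ z₁₀^e₁₀ a^p b^q  (eᵢ ∈ ℕ, p q ∈ ℤ)
ZMon : Set
ZMon = Vec ℕ 10 × ℤ × ℤ

module Setup {c ℓ} (R : CommutativeRing c ℓ) (ζ : CommutativeRing.Carrier R) where
  open CommutativeRing R

  LPoly : Set c
  LPoly = List (Carrier × XMon)

  ZPoly : Set c
  ZPoly = List (Carrier × ZMon)

  coeff : LPoly → XMon → Carrier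
  coeff [] m = 0#
  coeff ((a , n) ∷ p) m with m ≟X n
  ... | yes _ = a + coeff p m
  ... | no  _ = coeff p m

  _≋_ : LPoly → LPoly → Set ℓ
  p ≋ q = ∀ m → coeff p m ≈ coeff q m

  one : LPoly
  one = (1# , X1) ∷ []

  _⊗_ : LPoly → LPoly → LPoly
  p ⊗ q = concatMap (λ { (a , m) → map (λ { (b , n) → (a * b , m ·X n) }) q }) p

  _^^_ : LPoly → ℕ → LPoly
  p ^^ zero  = one
  p ^^ suc n = p ⊗ (p ^^ n)

  scale : Carrier → LPoly → LPoly
  scale a = map (λ { (b , n) → (a * b , n) })

  ζ² : Carrier
  ζ² = ζ * ζ

  _^_ : Carrier → ℕ → Carrier
  x ^ zero  = 1#
  x ^ suc n = x * (x ^ n)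

  mon : ℕ → ℕ → ℕ → ℤ → ℤ → XMon
  mon e₁ e₂ e₃ a b = (e₁ , e₂ , e₃ , a , b)

  θz : Fin 10 → LPoly
  θz i = lookup table i
    where
    table : Vec LPoly 10
    table =
      ((1# , mon 3 0 0 (+ 0) (+ 0)) ∷ (1# , mon 0 3 0 (+ 0) (+ 0)) ∷ (1# , mon 0 0 3 (+ 0) (+ 0)) ∷ []) ∷
      ((ζ² , mon 3 0 0 (+ 2) (+ 0)) ∷ (ζ , mon 0 3 0 (+ 2) (+ 0)) ∷ (1# , mon 0 0 3 (+ 2) (+ 0)) ∷ []) ∷
      ((ζ , mon 3 0 0 (+ 1) (+ 0)) ∷ (ζ² , mon 0 3 0 (+ 1) (+ 0)) ∷ (1# , mon 0 0 3 (+ 1) (+ 0)) ∷ []) ∷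
      ((1# , mon 2 0 1 (+ 0) (+ 2)) ∷ (1# , mon 1 2 0 (+ 0) (+ 2)) ∷ (1# , mon 0 1 2 (+ 0) (+ 2)) ∷ []) ∷
      ((ζ² , mon 2 0 1 (+ 2) (+ 2)) ∷ (ζ , mon 1 2 0 (+ 2) (+ 2)) ∷ (1# , mon 0 1 2 (+ 2) (+ 2)) ∷ []) ∷
      ((ζ , mon 2 0 1 (+ 1) (+ 2)) ∷ (ζ² , mon 1 2 0 (+ 1) (+ 2)) ∷ (1# , mon 0 1 2 (+ 1) (+ 2)) ∷ []) ∷
      ((1# , mon 2 1 0 (+ 0) (+ 1)) ∷ (1# , mon 0 2 1 (+ 0) (+ 1)) ∷ (1# , mon 1 0 2 (+ 0) (+ 1)) ∷ []) ∷
      ((ζ² , mon 2 1 0 (+ 2) (+ 1)) ∷ (ζ , mon 0 2 1 (+ 2) (+ 1)) ∷ (1# , mon 1 0 2 (+ 2) (+ 1)) ∷ []) ∷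
      ((ζ , mon 2 1 0 (+ 1) (+ 1)) ∷ (ζ² , mon 0 2 1 (+ 1) (+ 1)) ∷ (1# , mon 1 0 2 (+ 1) (+ 1)) ∷ []) ∷
      ((1# , mon 1 1 1 (+ 0) (+ 0)) ∷ []) ∷
      []

  θmon : ZMon → LPoly
  θmon (e , p , q) = prodFin 10 (λ i → θz i ^^ lookup e i) ⊗ ((1# , mon 0 0 0 (+ 3 ℤ.* p) (+ 3 ℤ.* q)) ∷ [])
    where
    prodFin : (n : ℕ) → (Fin n → LPoly) → LPoly
    prodFin zero    g = one
    prodFin (suc n) g = g Data.Fin.zero ⊗ prodFin n (λ i → g (Data.Fin.suc i))

  θ : ZPoly → LPoly
  θ = concatMap (λ { (a , m) → scale a (θmon m) })

  Image : LPoly → Set (c ⊔ ℓ)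
  Image f = Σ ZPoly λ P → θ P ≋ f

  -- ζ^n for n ∈ ℤ (ζ^{-1} = ζ²)
  ζ^ : ℤ → Carrier
  ζ^ (+ n)      = ζ ^ n
  ζ^ (-[1+ n ]) = ζ² ^ suc n

  -- E₁₃ : xᵢ ↦ ζxᵢ
  actE13 : LPoly → LPoly
  actE13 = map (λ { (c' , (e₁ , e₂ , e₃ , a , b)) → (c' * ζ ^ (e₁ ℕ.+ e₂ ℕ.+ e₃) , (e₁ , e₂ , e₃ , a , b)) })

  -- E₁₂ : x₁ ↦ x₂ ↦ x₃ ↦ x₁, α ↦ ζα
  actE12 : LPoly → LPoly
  actE12 = map (λ { (c' , (e₁ , e₂ , e₃ , a , b)) → (c' * ζ^ a , (e₃ , e₁ , e₂ , a , b)) })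

  -- E₂₃ : x₂ ↦ ζ²x₂, x₃ ↦ ζx₃, β ↦ ζβ
  actE23 : LPoly → LPoly
  actE23 = map (λ { (c' , (e₁ , e₂ , e₃ , a , b)) → (c' * (ζ² ^ e₂ * ζ ^ e₃) * ζ^ b , (e₁ , e₂ , e₃ , a , b)) })

  iter : ℕ → (LPoly → LPoly) → LPoly → LPoly
  iter zero    g = λ f → f
  iter (suc n) g = λ f → g (iter n g f)

  -- Elements of H: the matrix [[1,a,c],[0,1,b],[0,0,1]] over ℤ/3 is
  -- represented by (a , b , c).  It equals E₁₂^a E₂₃^b E₁₃^(c - ab),
  -- so it acts by  f ↦ E₁₂^a · (E₂₃^b · (E₁₃^(c-ab) · f)),  where
  -- c - ab ≡ c + 2ab (mod 3).
  H : Set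
  H = Fin 3 × Fin 3 × Fin 3

  act : H → LPoly → LPoly
  act (a , b , c') f =
    iter (toℕ a) actE12 (iter (toℕ b) actE23
      (iter ((toℕ c' ℕ.+ 2 ℕ.* toℕ a ℕ.* toℕ b) ℕ.% 3) actE13 f))

  Invariant : LPoly → Set (ℓ)
  Invariant f = ∀ g → act g f ≋ f

-- Every generator θ(zᵢ) and every α^{±3}, β^{±3} is fixed by E₁₂, E₂₃ and E₁₃, and the action is by
-- algebra automorphisms, so the image of θ is invariant.  Conversely, averaging an invariant f over
-- the 27 elements of H (possible as 27 is invertible in k) writes it as a combination of the averages
-- of its monomials; the average of a monomial m is (1 + χ₁₃ m + χ₁₃ m²)(1 + χ₂₃ m + χ₂₃ m²) times
-- the twisted E₁₂-orbit sum of m, where χ₁₃, χ₂₃ are the cube roots of unity by which E₁₃, E₂₃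
-- scale m.  That factor vanishes unless the degree and the E₂₃-weight of m are divisible by 3.
-- In that case the orbit sum lies in the image, by induction on the degree: m is divisible by one
-- of ten cubic monomials u, and summing orbit(α^j u) · orbit(α^{-j} m/u) over j ∈ ℤ/3 gives
-- 3 · orbit(m), where each orbit(α^j u) is a unit multiple of a generator θ(zᵢ) (or 0).
module Submission where

open import Defs
open import Level using (Level; _⊔_)
open import Algebra.Bundles using (CommutativeRing)
open import Algebra.Morphism.Structures using (module RingMorphisms)
open import Data.Nat as ℕ using (ℕ; zero; suc)
import Data.Nat.Properties as ℕP
import Data.Nat.DivMod as ℕD
open import Data.Nat.Tactic.RingSolver using () renaming (solve-∀ to solve-∀ℕ)
open import Data.Integer as ℤ using (ℤ; +_; -[1+_])
import Data.Integer.Properties as ℤP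
import Data.Integer.DivMod as ℤD
open import Data.Integer.Tactic.RingSolver using (solve-∀)
open import Data.Rational as ℚ using (ℚ)
import Data.Rational.Properties as ℚP
open import Data.Fin as Fin using (Fin; toℕ; inject₁)
open import Data.Fin.Properties using (all?; toℕ<n)
open import Data.Fin.Relation.Unary.Top using (view; ‵fromℕ; ‵inj₁)
open import Data.Vec using (Vec; []; _∷_; replicate; updateAt)
open import Data.List using (List; []; _∷_; _++_; map; concatMap; length)
open import Data.List.Properties using (map-++; concatMap-++; ++-identityʳ)
open import Data.List.Relation.Unary.All as All using (All; []; _∷_)
open import Data.Product using (Σ; _,_; proj₁; proj₂; map₁; map₂)
open import Data.Sum using (_⊎_; inj₁; inj₂)
open import Data.Empty using (⊥-elim)
open import Function.Base using (id)
open import Function.Bundles using (_⇔_; mk⇔)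
open import Relation.Nullary using (¬_; yes; no)
open import Relation.Nullary.Decidable using (from-yes)
open import Relation.Binary.PropositionalEquality as P using (_≡_)
open import Relation.Binary.Bundles using (Setoid)
import Relation.Binary.Reasoning.Setoid


module ListSums {c ℓ} (k : CommutativeRing c ℓ) where
  open CommutativeRing k
  open import Algebra.Properties.Ring ring using (-0#≈0#; -‿+-comm)
  open import Algebra.Properties.Semiring.Mult semiring using (_×_)
  open import Algebra.Solver.Ring.NaturalCoefficients.Default commutativeSemiring

  private variable
    a b : Level
    A B : Set a

  ∑ : List A → (A → Carrier) → Carrier
  ∑ []       f = 0#
  ∑ (x ∷ xs) f = f x + ∑ xs f

  ∑-cong : ∀ (xs : List A) {f g : A → Carrier} → (∀ x → f x ≈ g x) → ∑ xs f ≈ ∑ xs g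
  ∑-cong []       f≈g = refl
  ∑-cong (x ∷ xs) f≈g = +-cong (f≈g x) (∑-cong xs f≈g)

  ∑-++ : ∀ (xs ys : List A) f → ∑ (xs ++ ys) f ≈ ∑ xs f + ∑ ys f
  ∑-++ []       ys f = sym (+-identityˡ _)
  ∑-++ (x ∷ xs) ys f = trans (+-cong refl (∑-++ xs ys f)) (sym (+-assoc _ _ _))

  ∑-map : ∀ (g : B → A) (xs : List B) f → ∑ (map g xs) f ≡ ∑ xs (λ x → f (g x))
  ∑-map g []       f = P.refl
  ∑-map g (x ∷ xs) f = P.cong (λ s → f (g x) + s) (∑-map g xs f)

  ∑-concatMap : ∀ (g : B → List A) (xs : List B) f →
                ∑ (concatMap g xs) f ≈ ∑ xs (λ x → ∑ (g x) f)
  ∑-concatMap g []       f = refl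
  ∑-concatMap g (x ∷ xs) f = trans (∑-++ (g x) (concatMap g xs) f) (+-cong refl (∑-concatMap g xs f))

  ∑-+ : ∀ (xs : List A) f g → ∑ xs (λ x → f x + g x) ≈ ∑ xs f + ∑ xs g
  ∑-+ []       f g = sym (+-identityˡ _)
  ∑-+ (x ∷ xs) f g = trans (+-cong refl (∑-+ xs f g))
    (solve 4 (λ a b c d → (a :+ b) :+ (c :+ d) := (a :+ c) :+ (b :+ d)) refl _ _ _ _)

  ∑-*ˡ : ∀ (xs : List A) u f → ∑ xs (λ x → u * f x) ≈ u * ∑ xs f
  ∑-*ˡ []       u f = sym (zeroʳ u)
  ∑-*ˡ (x ∷ xs) u f = trans (+-cong refl (∑-*ˡ xs u f)) (sym (distribˡ u _ _))

  ∑-*ʳ : ∀ (xs : List A) f u → ∑ xs (λ x → f x * u) ≈ ∑ xs f * u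
  ∑-*ʳ []       f u = sym (zeroˡ u)
  ∑-*ʳ (x ∷ xs) f u = trans (+-cong refl (∑-*ʳ xs f u)) (sym (distribʳ u _ _))

  ∑-neg : ∀ (xs : List A) f → ∑ xs (λ x → - f x) ≈ - ∑ xs f
  ∑-neg []       f = sym -0#≈0#
  ∑-neg (x ∷ xs) f = trans (+-cong refl (∑-neg xs f)) (-‿+-comm _ _)

  ∑-zero : ∀ (xs : List A) → ∑ xs (λ _ → 0#) ≈ 0#
  ∑-zero []       = refl
  ∑-zero (x ∷ xs) = trans (+-identityˡ _) (∑-zero xs)

  ∑-const : ∀ (xs : List A) u → ∑ xs (λ _ → u) ≈ length xs × u
  ∑-const []       u = refl
  ∑-const (x ∷ xs) u = +-cong refl (∑-const xs u)

  ∑-swap : ∀ (xs : List A) (ys : List B) (f : A → B → Carrier) →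
           ∑ xs (λ x → ∑ ys (f x)) ≈ ∑ ys (λ y → ∑ xs (λ x → f x y))
  ∑-swap []       ys f = sym (∑-zero ys)
  ∑-swap (x ∷ xs) ys f =
    trans (+-cong refl (∑-swap xs ys f)) (sym (∑-+ ys (f x) (λ y → ∑ xs (λ x′ → f x′ y))))

  module ≈-Reasoning = Relation.Binary.Reasoning.Setoid setoid

module Pairing {c ℓ} (k : CommutativeRing c ℓ) (ζ : CommutativeRing.Carrier k) where
  open CommutativeRing k
  open Setup k ζ
  open ListSums k public
  open import Algebra.Properties.Ring ring using (-‿distribˡ-*)
  open import Algebra.Properties.Group +-group using (x∙y⁻¹≈ε⇒x≈y)
  open import Relation.Binary.Reasoning.Setoid setoid
  open import Algebra.Solver.Ring.NaturalCoefficients.Default commutativeSemiring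

  private variable
    a : Level
    A : Set a

  -- A Laurent polynomial is handled through the linear functional it defines on
  -- test functions h : XMon → k; two polynomials are equal iff these agree.
  ⟪_⟫ : LPoly → (XMon → Carrier) → Carrier
  ⟪ p ⟫ h = ∑ p (λ t → proj₁ t * h (proj₂ t))

  infix 4 _≈ᴾ_
  record _≈ᴾ_ (p q : LPoly) : Set (c ⊔ ℓ) where
    field pointwise : ∀ h → ⟪ p ⟫ h ≈ ⟪ q ⟫ h
  open _≈ᴾ_ public

  ⟪⟫-cong : ∀ p {h h′} → (∀ n → h n ≈ h′ n) → ⟪ p ⟫ h ≈ ⟪ p ⟫ h′
  ⟪⟫-cong p h≈h′ = ∑-cong p (λ t → *-cong refl (h≈h′ (proj₂ t)))

  ⟪⟫-++ : ∀ p q h → ⟪ p ++ q ⟫ h ≈ ⟪ p ⟫ h + ⟪ q ⟫ h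
  ⟪⟫-++ p q h = ∑-++ p q _

  ⟪⟫-*ˡ : ∀ p u h → ⟪ p ⟫ (λ n → u * h n) ≈ u * ⟪ p ⟫ h
  ⟪⟫-*ˡ p u h = trans (∑-cong p (λ t → solve 3 (λ a b c → a :* (b :* c) := b :* (a :* c)) refl (proj₁ t) u (h (proj₂ t))))
                      (∑-*ˡ p u _)

  ⟪⟫-+ : ∀ p h h′ → ⟪ p ⟫ (λ n → h n + h′ n) ≈ ⟪ p ⟫ h + ⟪ p ⟫ h′
  ⟪⟫-+ p h h′ = trans (∑-cong p (λ t → distribˡ _ _ _)) (∑-+ p _ _)

  ⟪⟫-zero : ∀ p → ⟪ p ⟫ (λ _ → 0#) ≈ 0#
  ⟪⟫-zero p = trans (∑-cong p (λ t → zeroʳ _)) (∑-zero p)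

  ⟪⟫-∑ : ∀ (xs : List A) p (F : A → XMon → Carrier) →
         ∑ xs (λ x → ⟪ p ⟫ (F x)) ≈ ⟪ p ⟫ (λ n → ∑ xs (λ x → F x n))
  ⟪⟫-∑ xs p F = trans (∑-swap xs p (λ x t → proj₁ t * F x (proj₂ t)))
                      (∑-cong p (λ t → ∑-*ˡ xs (proj₁ t) (λ x → F x (proj₂ t))))

  ⟪⟫-swap : ∀ p q (F : XMon → XMon → Carrier) →
            ⟪ p ⟫ (λ n → ⟪ q ⟫ (F n)) ≈ ⟪ q ⟫ (λ n′ → ⟪ p ⟫ (λ n → F n n′))
  ⟪⟫-swap p q F = trans (∑-cong p (λ t → sym (⟪⟫-*ˡ q (proj₁ t) (F (proj₂ t)))))
                        (⟪⟫-∑ p q (λ t n′ → proj₁ t * F (proj₂ t) n′))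

  ⟪scale⟫ : ∀ u p h → ⟪ scale u p ⟫ h ≈ u * ⟪ p ⟫ h
  ⟪scale⟫ u p h = trans (reflexive (∑-map _ p _)) (trans (∑-cong p (λ t → *-assoc _ _ _)) (∑-*ˡ p u _))

  ⟪⊗⟫ : ∀ p q h → ⟪ p ⊗ q ⟫ h ≈ ⟪ p ⟫ (λ n → ⟪ q ⟫ (λ n′ → h (n ·X n′)))
  ⟪⊗⟫ p q h = trans (∑-concatMap _ p _) (∑-cong p (λ t →
    trans (reflexive (∑-map _ q _)) (trans (∑-cong q (λ s → *-assoc _ _ _)) (∑-*ˡ q (proj₁ t) _))))

  δ : XMon → XMon → Carrier
  δ m n with m ≟X n
  ... | yes _ = 1#
  ... | no  _ = 0#

  coeff≈⟪⟫δ : ∀ p m → coeff p m ≈ ⟪ p ⟫ (δ m)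
  coeff≈⟪⟫δ []            m = refl
  coeff≈⟪⟫δ ((a , n) ∷ p) m with m ≟X n
  ... | yes _ = +-cong (sym (*-identityʳ a)) (coeff≈⟪⟫δ p m)
  ... | no  _ = trans (coeff≈⟪⟫δ p m) (sym (trans (+-cong (zeroʳ a) refl) (+-identityˡ _)))

  ≈ᴾ⇒≋ : ∀ {p q} → p ≈ᴾ q → p ≋ q
  ≈ᴾ⇒≋ {p} {q} p≈q m = trans (coeff≈⟪⟫δ p m) (trans (pointwise p≈q (δ m)) (sym (coeff≈⟪⟫δ q m)))

  termsAt termsOff : XMon → LPoly → LPoly
  termsAt m [] = []
  termsAt m ((a , n) ∷ r) with m ≟X n
  ... | yes _ = (a , n) ∷ termsAt m r
  ... | no  _ = termsAt m r
  termsOff m [] = []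
  termsOff m ((a , n) ∷ r) with m ≟X n
  ... | yes _ = termsOff m r
  ... | no  _ = (a , n) ∷ termsOff m r

  ⟪⟫-split : ∀ m r h → ⟪ r ⟫ h ≈ ⟪ termsAt m r ⟫ h + ⟪ termsOff m r ⟫ h
  ⟪⟫-split m []            h = sym (+-identityˡ _)
  ⟪⟫-split m ((a , n) ∷ r) h with m ≟X n
  ... | yes _ = trans (+-cong refl (⟪⟫-split m r h)) (sym (+-assoc _ _ _))
  ... | no  _ = trans (+-cong refl (⟪⟫-split m r h)) (solve 3 (λ x y z → x :+ (y :+ z) := y :+ (x :+ z)) refl _ _ _)

  ⟪termsAt⟫ : ∀ m r h → ⟪ termsAt m r ⟫ h ≈ coeff r m * h m
  ⟪termsAt⟫ m []            h = sym (zeroˡ _)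
  ⟪termsAt⟫ m ((a , n) ∷ r) h with m ≟X n
  ... | yes P.refl = trans (+-cong refl (⟪termsAt⟫ m r h)) (sym (distribʳ _ _ _))
  ... | no  _      = ⟪termsAt⟫ m r h

  coeff-termsOff : ∀ m r n → ¬ n ≡ m → coeff (termsOff m r) n ≈ coeff r n
  coeff-termsOff m []            n n≢m = refl
  coeff-termsOff m ((a , l) ∷ r) n n≢m with m ≟X l
  coeff-termsOff m ((a , l) ∷ r) n n≢m | yes P.refl with n ≟X m
  ... | yes n≡m = ⊥-elim (n≢m n≡m)
  ... | no  _   = coeff-termsOff m r n n≢m
  coeff-termsOff m ((a , l) ∷ r) n n≢m | no _ with n ≟X l
  ... | yes _ = +-cong refl (coeff-termsOff m r n n≢m)
  ... | no  _ = coeff-termsOff m r n n≢m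

  coeff-termsOff-at : ∀ m r → coeff (termsOff m r) m ≈ 0#
  coeff-termsOff-at m [] = refl
  coeff-termsOff-at m ((a , n) ∷ r) with m ≟X n
  ... | yes _ = coeff-termsOff-at m r
  ... | no m≢n with m ≟X n
  ...   | yes m≡n = ⊥-elim (m≢n m≡n)
  ...   | no  _   = coeff-termsOff-at m r

  length-termsOff : ∀ m r → length (termsOff m r) ℕ.≤ length r
  length-termsOff m [] = ℕ.z≤n
  length-termsOff m ((a , n) ∷ r) with m ≟X n
  ... | yes _ = ℕP.m≤n⇒m≤1+n (length-termsOff m r)
  ... | no  _ = ℕ.s≤s (length-termsOff m r)

  -- Strong induction on the length of r, in the form of a fuel argument.
  coeff-zero⇒⟪⟫-zero : ∀ fuel r → length r ℕ.≤ fuel → (∀ m → coeff r m ≈ 0#) → ∀ h → ⟪ r ⟫ h ≈ 0#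
  coeff-zero⇒⟪⟫-zero fuel       []            _ _ h = refl
  coeff-zero⇒⟪⟫-zero (suc fuel) ((a , n) ∷ r) (ℕ.s≤s len≤) r≈0 h = begin
    a * h n + ⟪ r ⟫ h                                            ≈⟨ +-cong refl (⟪⟫-split n r h) ⟩
    a * h n + (⟪ termsAt n r ⟫ h + ⟪ termsOff n r ⟫ h)           ≈⟨ +-cong refl (+-cong (⟪termsAt⟫ n r h) rest≈0) ⟩
    a * h n + (coeff r n * h n + 0#)                              ≈⟨ solve 3 (λ x y u → x :* u :+ (y :* u :+ con 0) := (x :+ y) :* u) refl _ _ _ ⟩
    (a + coeff r n) * h n                                        ≈⟨ *-cong at-n refl ⟩
    0# * h n                                                     ≈⟨ zeroˡ _ ⟩
    0# ∎
    where
    at-n : a + coeff r n ≈ 0#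
    at-n with r≈0 n
    ... | e with n ≟X n
    ...   | yes _   = e
    ...   | no  n≢n = ⊥-elim (n≢n P.refl)
    off≈0 : ∀ m → coeff (termsOff n r) m ≈ 0#
    off≈0 m with m ≟X n | r≈0 m
    ... | yes P.refl | _ = coeff-termsOff-at n r
    ... | no  m≢n    | e = trans (coeff-termsOff n r m m≢n) e
    rest≈0 : ⟪ termsOff n r ⟫ h ≈ 0#
    rest≈0 = coeff-zero⇒⟪⟫-zero fuel (termsOff n r) (ℕP.≤-trans (length-termsOff n r) len≤) off≈0 h

  negate : LPoly → LPoly
  negate = map (λ t → - proj₁ t , proj₂ t)

  ⟪negate⟫ : ∀ q h → ⟪ negate q ⟫ h ≈ - ⟪ q ⟫ h
  ⟪negate⟫ q h = trans (reflexive (∑-map _ q _)) (trans (∑-cong q (λ t → sym (-‿distribˡ-* _ _))) (∑-neg q _))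

  ≋⇒≈ᴾ : ∀ {p q} → p ≋ q → p ≈ᴾ q
  pointwise (≋⇒≈ᴾ {p} {q} p≋q) h = x∙y⁻¹≈ε⇒x≈y _ _ (begin
    ⟪ p ⟫ h - ⟪ q ⟫ h           ≈⟨ +-cong refl (sym (⟪negate⟫ q h)) ⟩
    ⟪ p ⟫ h + ⟪ negate q ⟫ h    ≈⟨ sym (⟪⟫-++ p (negate q) h) ⟩
    ⟪ p ++ negate q ⟫ h         ≈⟨ coeff-zero⇒⟪⟫-zero _ (p ++ negate q) ℕP.≤-refl difference≈0 h ⟩
    0# ∎)
    where
    difference≈0 : ∀ m → coeff (p ++ negate q) m ≈ 0#
    difference≈0 m = begin
      coeff (p ++ negate q) m                 ≈⟨ coeff≈⟪⟫δ (p ++ negate q) m ⟩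
      ⟪ p ++ negate q ⟫ (δ m)                 ≈⟨ ⟪⟫-++ p (negate q) (δ m) ⟩
      ⟪ p ⟫ (δ m) + ⟪ negate q ⟫ (δ m)        ≈⟨ +-cong (sym (coeff≈⟪⟫δ p m)) (⟪negate⟫ q (δ m)) ⟩
      coeff p m - ⟪ q ⟫ (δ m)                 ≈⟨ +-cong (p≋q m) (-‿cong (sym (coeff≈⟪⟫δ q m))) ⟩
      coeff q m - coeff q m                   ≈⟨ -‿inverseʳ _ ⟩
      0# ∎

  ·X-comm : ∀ m n → m ·X n ≡ n ·X m
  ·X-comm (a₁ , a₂ , a₃ , a₄ , a₅) (b₁ , b₂ , b₃ , b₄ , b₅)
    rewrite ℕP.+-comm a₁ b₁ | ℕP.+-comm a₂ b₂ | ℕP.+-comm a₃ b₃ | ℤP.+-comm a₄ b₄ | ℤP.+-comm a₅ b₅ = P.refl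

  ·X-assoc : ∀ m n o → (m ·X n) ·X o ≡ m ·X (n ·X o)
  ·X-assoc (a₁ , a₂ , a₃ , a₄ , a₅) (b₁ , b₂ , b₃ , b₄ , b₅) (c₁ , c₂ , c₃ , c₄ , c₅)
    rewrite ℕP.+-assoc a₁ b₁ c₁ | ℕP.+-assoc a₂ b₂ c₂ | ℕP.+-assoc a₃ b₃ c₃
          | ℤP.+-assoc a₄ b₄ c₄ | ℤP.+-assoc a₅ b₅ c₅ = P.refl

  X1-·X : ∀ n → X1 ·X n ≡ n
  X1-·X (a₁ , a₂ , a₃ , a₄ , a₅) rewrite ℤP.+-identityˡ a₄ | ℤP.+-identityˡ a₅ = P.refl

  ≈ᴾ-refl : ∀ {p} → p ≈ᴾ p
  pointwise ≈ᴾ-refl h = refl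

  ≈ᴾ-reflexive : ∀ {p q} → p ≡ q → p ≈ᴾ q
  ≈ᴾ-reflexive P.refl = ≈ᴾ-refl

  ≈ᴾ-sym : ∀ {p q} → p ≈ᴾ q → q ≈ᴾ p
  pointwise (≈ᴾ-sym p≈q) h = sym (pointwise p≈q h)

  ≈ᴾ-trans : ∀ {p q r} → p ≈ᴾ q → q ≈ᴾ r → p ≈ᴾ r
  pointwise (≈ᴾ-trans p≈q q≈r) h = trans (pointwise p≈q h) (pointwise q≈r h)

  ≈ᴾ-setoid : Setoid c (c ⊔ ℓ)
  ≈ᴾ-setoid = record
    { Carrier = LPoly ; _≈_ = _≈ᴾ_
    ; isEquivalence = record { refl = ≈ᴾ-refl ; sym = ≈ᴾ-sym ; trans = ≈ᴾ-trans } }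

  module ≈ᴾ-Reasoning = Relation.Binary.Reasoning.Setoid ≈ᴾ-setoid

  scale-congʳ : ∀ u {p q} → p ≈ᴾ q → scale u p ≈ᴾ scale u q
  pointwise (scale-congʳ u {p} {q} p≈q) h = trans (⟪scale⟫ u p h) (trans (*-cong refl (pointwise p≈q h)) (sym (⟪scale⟫ u q h)))

  scale-congˡ : ∀ {u v} p → u ≈ v → scale u p ≈ᴾ scale v p
  pointwise (scale-congˡ {u} {v} p u≈v) h = trans (⟪scale⟫ u p h) (trans (*-cong u≈v refl) (sym (⟪scale⟫ v p h)))

  scale-* : ∀ u v p → scale u (scale v p) ≈ᴾ scale (u * v) p
  pointwise (scale-* u v p) h = trans (⟪scale⟫ u (scale v p) h) (trans (*-cong refl (⟪scale⟫ v p h))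
                    (trans (sym (*-assoc _ _ _)) (sym (⟪scale⟫ (u * v) p h))))

  scale-1 : ∀ {u} p → u ≈ 1# → scale u p ≈ᴾ p
  pointwise (scale-1 {u} p u≈1) h = trans (⟪scale⟫ u p h) (trans (*-cong u≈1 refl) (*-identityˡ _))

  scale-0 : ∀ {u} p → u ≈ 0# → scale u p ≈ᴾ []
  pointwise (scale-0 {u} p u≈0) h = trans (⟪scale⟫ u p h) (trans (*-cong u≈0 refl) (zeroˡ _))

  ⊗-congˡ : ∀ {p p′} q → p ≈ᴾ p′ → p ⊗ q ≈ᴾ p′ ⊗ q
  pointwise (⊗-congˡ {p} {p′} q p≈p′) h = trans (⟪⊗⟫ p q h) (trans (pointwise p≈p′ _) (sym (⟪⊗⟫ p′ q h)))

  ⊗-congʳ : ∀ p {q q′} → q ≈ᴾ q′ → p ⊗ q ≈ᴾ p ⊗ q′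
  pointwise (⊗-congʳ p {q} {q′} q≈q′) h = trans (⟪⊗⟫ p q h) (trans (⟪⟫-cong p (λ n → pointwise q≈q′ _)) (sym (⟪⊗⟫ p q′ h)))

  ⊗-comm : ∀ p q → p ⊗ q ≈ᴾ q ⊗ p
  pointwise (⊗-comm p q) h = trans (⟪⊗⟫ p q h) (trans (⟪⟫-swap p q _)
    (trans (⟪⟫-cong q (λ n′ → ⟪⟫-cong p (λ n → reflexive (P.cong h (·X-comm n n′))))) (sym (⟪⊗⟫ q p h))))

  ⊗-assoc : ∀ p q r → (p ⊗ q) ⊗ r ≈ᴾ p ⊗ (q ⊗ r)
  pointwise (⊗-assoc p q r) h = begin
    ⟪ (p ⊗ q) ⊗ r ⟫ h                                                ≈⟨ ⟪⊗⟫ (p ⊗ q) r h ⟩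
    ⟪ p ⊗ q ⟫ (λ m → ⟪ r ⟫ (λ m′ → h (m ·X m′)))                     ≈⟨ ⟪⊗⟫ p q _ ⟩
    ⟪ p ⟫ (λ n → ⟪ q ⟫ (λ n′ → ⟪ r ⟫ (λ m′ → h ((n ·X n′) ·X m′))))
      ≈⟨ ⟪⟫-cong p (λ n → ⟪⟫-cong q (λ n′ → ⟪⟫-cong r (λ m′ → reflexive (P.cong h (·X-assoc n n′ m′))))) ⟩
    ⟪ p ⟫ (λ n → ⟪ q ⟫ (λ n′ → ⟪ r ⟫ (λ m′ → h (n ·X (n′ ·X m′)))))  ≈⟨ ⟪⟫-cong p (λ n → sym (⟪⊗⟫ q r _)) ⟩
    ⟪ p ⟫ (λ n → ⟪ q ⊗ r ⟫ (λ m → h (n ·X m)))                       ≈⟨ sym (⟪⊗⟫ p (q ⊗ r) h) ⟩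
    ⟪ p ⊗ (q ⊗ r) ⟫ h ∎

  one-⊗ : ∀ p → one ⊗ p ≈ᴾ p
  pointwise (one-⊗ p) h = trans (⟪⊗⟫ one p h) (trans (+-identityʳ _) (trans (*-identityˡ _)
    (⟪⟫-cong p (λ n → reflexive (P.cong h (X1-·X n))))))

  scale-⊗ : ∀ u p q → scale u p ⊗ q ≈ᴾ scale u (p ⊗ q)
  pointwise (scale-⊗ u p q) h = trans (⟪⊗⟫ (scale u p) q h) (trans (⟪scale⟫ u p _)
    (trans (*-cong refl (sym (⟪⊗⟫ p q h))) (sym (⟪scale⟫ u (p ⊗ q) h))))

  ⊗-scale : ∀ u p q → p ⊗ scale u q ≈ᴾ scale u (p ⊗ q)
  ⊗-scale u p q = ≈ᴾ-trans (⊗-comm p (scale u q)) (≈ᴾ-trans (scale-⊗ u q p) (scale-congʳ u (⊗-comm q p)))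

  ++-cong : ∀ {p p′ q q′} → p ≈ᴾ p′ → q ≈ᴾ q′ → p ++ q ≈ᴾ p′ ++ q′
  pointwise (++-cong {p} {p′} {q} {q′} p≈p′ q≈q′) h =
    trans (⟪⟫-++ p q h) (trans (+-cong (pointwise p≈p′ h) (pointwise q≈q′ h)) (sym (⟪⟫-++ p′ q′ h)))

  ⊗-++ : ∀ p q r → p ⊗ (q ++ r) ≈ᴾ p ⊗ q ++ p ⊗ r
  pointwise (⊗-++ p q r) h = begin
    ⟪ p ⊗ (q ++ r) ⟫ h                                   ≈⟨ ⟪⊗⟫ p (q ++ r) h ⟩
    ⟪ p ⟫ (λ n → ⟪ q ++ r ⟫ (λ n′ → h (n ·X n′)))        ≈⟨ ⟪⟫-cong p (λ n → ⟪⟫-++ q r _) ⟩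
    ⟪ p ⟫ (λ n → ⟪ q ⟫ (λ n′ → h (n ·X n′)) + ⟪ r ⟫ (λ n′ → h (n ·X n′)))  ≈⟨ ⟪⟫-+ p _ _ ⟩
    ⟪ p ⟫ (λ n → ⟪ q ⟫ (λ n′ → h (n ·X n′))) + ⟪ p ⟫ (λ n → ⟪ r ⟫ (λ n′ → h (n ·X n′)))
      ≈⟨ +-cong (sym (⟪⊗⟫ p q h)) (sym (⟪⊗⟫ p r h)) ⟩
    ⟪ p ⊗ q ⟫ h + ⟪ p ⊗ r ⟫ h                            ≈⟨ sym (⟪⟫-++ (p ⊗ q) (p ⊗ r) h) ⟩
    ⟪ p ⊗ q ++ p ⊗ r ⟫ h ∎

  ⊗-[] : ∀ p → p ⊗ [] ≈ᴾ []
  pointwise (⊗-[] p) h = trans (⟪⊗⟫ p [] h) (⟪⟫-zero p)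

module CubeRoot {c ℓ} (k : CommutativeRing c ℓ) (ζ : CommutativeRing.Carrier k) where
  open CommutativeRing k
  open Setup k ζ
  open import Relation.Binary.Reasoning.Setoid setoid
  open import Algebra.Solver.Ring.NaturalCoefficients.Default commutativeSemiring

  cubeSum : Carrier → Carrier
  cubeSum x = 1# + x + x * x

  pow-+ : ∀ x m n → x ^ (m ℕ.+ n) ≈ x ^ m * x ^ n
  pow-+ x zero    n = sym (*-identityˡ _)
  pow-+ x (suc m) n = trans (*-cong refl (pow-+ x m n)) (sym (*-assoc _ _ _))

  pow-* : ∀ x y n → (x * y) ^ n ≈ x ^ n * y ^ n
  pow-* x y zero    = sym (*-identityˡ _)
  pow-* x y (suc n) = trans (*-cong refl (pow-* x y n))
    (solve 4 (λ a b c d → (a :* b) :* (c :* d) := (a :* c) :* (b :* d)) refl _ _ _ _)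

  pow-cong : ∀ {x y} n → x ≈ y → x ^ n ≈ y ^ n
  pow-cong zero    x≈y = refl
  pow-cong (suc n) x≈y = *-cong x≈y (pow-cong n x≈y)

  pow-of-one : ∀ n → 1# ^ n ≈ 1#
  pow-of-one zero    = refl
  pow-of-one (suc n) = trans (*-identityˡ _) (pow-of-one n)

  cube-of-pow : ∀ x n → x * x * x ≈ 1# → x ^ n * x ^ n * x ^ n ≈ 1#
  cube-of-pow x n x³≈1 = trans (sym (trans (pow-* (x * x) x n) (*-cong (pow-* x x n) refl)))
                               (trans (pow-cong n x³≈1) (pow-of-one n))

  module _ (ζ³≈1 : ζ * ζ * ζ ≈ 1#) where

    ζ*ζ²≈1 : ζ * ζ² ≈ 1#
    ζ*ζ²≈1 = trans (sym (*-assoc ζ ζ ζ)) ζ³≈1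

    ζ²³≈1 : ζ² * ζ² * ζ² ≈ 1#
    ζ²³≈1 = trans (solve 1 (λ z → (z :* z) :* (z :* z) :* (z :* z) := (z :* z :* z) :* (z :* z :* z)) refl ζ)
                  (trans (*-cong ζ³≈1 ζ³≈1) (*-identityˡ _))

    ζ^3≈1 : ζ ^ 3 ≈ 1#
    ζ^3≈1 = trans (solve 1 (λ z → z :* (z :* (z :* con 1)) := z :* z :* z) refl ζ) ζ³≈1

    ζ^[q*3]≈1 : ∀ q → ζ ^ (q ℕ.* 3) ≈ 1#
    ζ^[q*3]≈1 zero    = refl
    ζ^[q*3]≈1 (suc q) = trans (pow-+ ζ 3 (q ℕ.* 3)) (trans (*-cong ζ^3≈1 (ζ^[q*3]≈1 q)) (*-identityˡ _))

    ζ^ℕ-mod : ∀ n → ζ ^ n ≈ ζ ^ (n ℕ.% 3)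
    ζ^ℕ-mod n = begin
      ζ ^ n                                   ≡⟨ P.cong (ζ ^_) (ℕD.m≡m%n+[m/n]*n n 3) ⟩
      ζ ^ (n ℕ.% 3 ℕ.+ (n ℕ./ 3) ℕ.* 3)       ≈⟨ pow-+ ζ (n ℕ.% 3) _ ⟩
      ζ ^ (n ℕ.% 3) * ζ ^ ((n ℕ./ 3) ℕ.* 3)   ≈⟨ *-cong refl (ζ^[q*3]≈1 (n ℕ./ 3)) ⟩
      ζ ^ (n ℕ.% 3) * 1#                      ≈⟨ *-identityʳ _ ⟩
      ζ ^ (n ℕ.% 3) ∎

    ζ^-suc : ∀ z → ζ^ (+ 1 ℤ.+ z) ≈ ζ * ζ^ z
    ζ^-suc (+ n)           = refl
    ζ^-suc (-[1+ zero ])   = sym (trans (*-cong refl (*-identityʳ _)) ζ*ζ²≈1)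
    ζ^-suc (-[1+ suc n ])  = sym (trans (sym (*-assoc _ _ _)) (trans (*-cong ζ*ζ²≈1 refl) (*-identityˡ _)))

    ζ^-pred : ∀ z → ζ^ (-[1+ 0 ] ℤ.+ z) ≈ ζ² * ζ^ z
    ζ^-pred (+ zero)   = refl
    ζ^-pred (+ suc n)  = sym (trans (sym (*-assoc _ _ _)) (trans (*-cong ζ³≈1 refl) (*-identityˡ _)))
    ζ^-pred (-[1+ n ]) = refl

    ζ^-+ : ∀ x y → ζ^ (x ℤ.+ y) ≈ ζ^ x * ζ^ y
    ζ^-+ (+ zero) y = trans (reflexive (P.cong ζ^ (ℤP.+-identityˡ y))) (sym (*-identityˡ _))
    ζ^-+ (+ suc n) y = begin
      ζ^ (+ suc n ℤ.+ y)          ≡⟨ P.cong ζ^ (ℤP.+-assoc (+ 1) (+ n) y) ⟩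
      ζ^ (+ 1 ℤ.+ (+ n ℤ.+ y))    ≈⟨ ζ^-suc (+ n ℤ.+ y) ⟩
      ζ * ζ^ (+ n ℤ.+ y)          ≈⟨ *-cong refl (ζ^-+ (+ n) y) ⟩
      ζ * (ζ^ (+ n) * ζ^ y)       ≈⟨ sym (*-assoc _ _ _) ⟩
      ζ^ (+ suc n) * ζ^ y         ∎
    ζ^-+ (-[1+ zero ]) y = trans (ζ^-pred y) (*-cong (sym (*-identityʳ _)) refl)
    ζ^-+ (-[1+ suc n ]) y = begin
      ζ^ (-[1+ suc n ] ℤ.+ y)         ≡⟨ P.cong ζ^ (ℤP.+-assoc -[1+ 0 ] -[1+ n ] y) ⟩
      ζ^ (-[1+ 0 ] ℤ.+ (-[1+ n ] ℤ.+ y)) ≈⟨ ζ^-pred (-[1+ n ] ℤ.+ y) ⟩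
      ζ² * ζ^ (-[1+ n ] ℤ.+ y)        ≈⟨ *-cong refl (ζ^-+ -[1+ n ] y) ⟩
      ζ² * (ζ^ -[1+ n ] * ζ^ y)       ≈⟨ sym (*-assoc _ _ _) ⟩
      ζ^ (-[1+ suc n ]) * ζ^ y        ∎

    ζ^-cube : ∀ z → ζ^ z * ζ^ z * ζ^ z ≈ 1#
    ζ^-cube (+ n)      = cube-of-pow ζ n ζ³≈1
    ζ^-cube (-[1+ n ]) = cube-of-pow ζ² (suc n) ζ²³≈1

    ζ^[3*q]≈1 : ∀ q → ζ^ (+ 3 ℤ.* q) ≈ 1#
    ζ^[3*q]≈1 q = begin
      ζ^ (+ 3 ℤ.* q)            ≡⟨ P.cong ζ^ (three-times q) ⟩
      ζ^ (q ℤ.+ q ℤ.+ q)        ≈⟨ ζ^-+ (q ℤ.+ q) q ⟩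
      ζ^ (q ℤ.+ q) * ζ^ q       ≈⟨ *-cong (ζ^-+ q q) refl ⟩
      ζ^ q * ζ^ q * ζ^ q        ≈⟨ ζ^-cube q ⟩
      1# ∎
      where
      three-times : ∀ q → + 3 ℤ.* q ≡ q ℤ.+ q ℤ.+ q
      three-times = solve-∀

    ζ^-residue : ∀ r q → ζ^ (+ r ℤ.+ q ℤ.* + 3) ≈ ζ ^ r
    ζ^-residue r q = trans (ζ^-+ (+ r) (q ℤ.* + 3))
      (trans (*-cong refl (trans (reflexive (P.cong ζ^ (ℤP.*-comm q (+ 3)))) (ζ^[3*q]≈1 q))) (*-identityʳ _))

    ζ^-mod : ∀ z → ζ^ z ≈ ζ ^ (z ℤD.%ℕ 3)
    ζ^-mod z = trans (reflexive (P.cong ζ^ (ℤD.a≡a%ℕn+[a/ℕn]*n z 3))) (ζ^-residue (z ℤD.%ℕ 3) (z ℤD./ℕ 3))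

    ζ^-periodic : ∀ z → z ℤD.%ℕ 3 ≡ 0 → ζ^ z ≈ 1#
    ζ^-periodic z z%3≡0 = trans (ζ^-mod z) (reflexive (P.cong (ζ ^_) z%3≡0))

    module _ (cubeSum-ζ≈0 : cubeSum ζ ≈ 0#) where

      cubeSum-ζ^1 : cubeSum (ζ ^ 1) ≈ 0#
      cubeSum-ζ^1 = trans (solve 1 (λ z → con 1 :+ z :* con 1 :+ (z :* con 1) :* (z :* con 1)
                                        := con 1 :+ z :+ z :* z) refl ζ) cubeSum-ζ≈0

      cubeSum-ζ^2 : cubeSum (ζ ^ 2) ≈ 0#
      cubeSum-ζ^2 = begin
        1# + ζ ^ 2 + ζ ^ 2 * ζ ^ 2  ≈⟨ solve 1 (λ z → con 1 :+ z :* (z :* con 1) :+ (z :* (z :* con 1)) :* (z :* (z :* con 1))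
                                                 := con 1 :+ z :* z :+ z :* (z :* z :* z)) refl ζ ⟩
        1# + ζ * ζ + ζ * (ζ * ζ * ζ) ≈⟨ +-cong refl (trans (*-cong refl ζ³≈1) (*-identityʳ ζ)) ⟩
        1# + ζ * ζ + ζ              ≈⟨ solve 1 (λ z → con 1 :+ z :* z :+ z := con 1 :+ z :+ z :* z) refl ζ ⟩
        cubeSum ζ                   ≈⟨ cubeSum-ζ≈0 ⟩
        0# ∎

      residue-cases : ∀ r → r ℕ.< 3 → r ≡ 0 ⊎ cubeSum (ζ ^ r) ≈ 0#
      residue-cases 0 _ = inj₁ P.refl
      residue-cases 1 _ = inj₂ cubeSum-ζ^1
      residue-cases 2 _ = inj₂ cubeSum-ζ^2
      residue-cases (suc (suc (suc _))) (ℕ.s≤s (ℕ.s≤s (ℕ.s≤s ())))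

      ζ^ℕ-trichotomy : ∀ n → Σ ℕ (λ N → n ≡ N ℕ.* 3) ⊎ cubeSum (ζ ^ n) ≈ 0#
      ζ^ℕ-trichotomy n with residue-cases (n ℕ.% 3) (ℕD.m%n<n n 3)
      ... | inj₁ r≡0 = inj₁ (n ℕ./ 3 , P.trans (ℕD.m≡m%n+[m/n]*n n 3) (P.cong (ℕ._+ (n ℕ./ 3) ℕ.* 3) r≡0))
      ... | inj₂ sum≈0 = inj₂ (trans (+-cong (+-cong refl (ζ^ℕ-mod n)) (*-cong (ζ^ℕ-mod n) (ζ^ℕ-mod n))) sum≈0)

      ζ^-trichotomy : ∀ z → Σ ℤ (λ q → z ≡ + 3 ℤ.* q) ⊎ cubeSum (ζ^ z) ≈ 0#
      ζ^-trichotomy z with residue-cases (z ℤD.%ℕ 3) (ℤD.n%ℕd<d z 3)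
      ... | inj₁ r≡0 = inj₁ (z ℤD./ℕ 3 , P.trans z≡ (P.trans (P.cong (λ r → + r ℤ.+ q ℤ.* + 3) r≡0) (no-residue q)))
        where
        q : ℤ
        q = z ℤD./ℕ 3
        z≡ : z ≡ + (z ℤD.%ℕ 3) ℤ.+ q ℤ.* + 3
        z≡ = ℤD.a≡a%ℕn+[a/ℕn]*n z 3
        no-residue : ∀ q → + 0 ℤ.+ q ℤ.* + 3 ≡ + 3 ℤ.* q
        no-residue = solve-∀
      ... | inj₂ sum≈0 = inj₂ (trans (+-cong (+-cong refl (ζ^-mod z)) (*-cong (ζ^-mod z) (ζ^-mod z))) sum≈0)

module MonomialProducts {c ℓ} (k : CommutativeRing c ℓ) (ζ : CommutativeRing.Carrier k) where
  open CommutativeRing k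
  open Setup k ζ

  powerProduct : (n : ℕ) → (Fin n → LPoly) → Vec ℕ n → LPoly
  powerProduct zero    g []       = one
  powerProduct (suc n) g (e ∷ es) = (g Fin.zero ^^ e) ⊗ powerProduct n (λ i → g (Fin.suc i)) es

  αβ-cube : ℤ → ℤ → LPoly
  αβ-cube p q = (1# , mon 0 0 0 (+ 3 ℤ.* p) (+ 3 ℤ.* q)) ∷ []

  θmon≡ : ∀ e p q → θmon (e , p , q) ≡ powerProduct 10 θz e ⊗ αβ-cube p q
  θmon≡ (_ ∷ _ ∷ _ ∷ _ ∷ _ ∷ _ ∷ _ ∷ _ ∷ _ ∷ _ ∷ []) p q = P.refl

-- A k-linear operator on Laurent polynomials sending the monomial n to χ n · σ n,
-- given through its transpose T on test functions.
module MonomialOperator {c ℓ} (k : CommutativeRing c ℓ) (ζ : CommutativeRing.Carrier k)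
  (χ : XMon → CommutativeRing.Carrier k) (σ : XMon → XMon)
  (χ-·X : ∀ m n → CommutativeRing._≈_ k (χ (m ·X n)) (CommutativeRing._*_ k (χ m) (χ n)))
  (σ-·X : ∀ m n → σ (m ·X n) ≡ σ m ·X σ n)
  (χ-X1 : CommutativeRing._≈_ k (χ X1) (CommutativeRing.1# k)) (σ-X1 : σ X1 ≡ X1) where
  open import Data.Product using (_×_)
  open CommutativeRing k
  open Setup k ζ
  open Pairing k ζ
  open MonomialProducts k ζ
  open import Relation.Binary.Reasoning.Setoid setoid
  open import Algebra.Solver.Ring.NaturalCoefficients.Default commutativeSemiring

  T : (XMon → Carrier) → XMon → Carrier
  T h n = χ n * h (σ n)

  Fixed : LPoly → Set _
  Fixed X = ∀ h → ⟪ X ⟫ (T h) ≈ ⟪ X ⟫ h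

  Fixed-≈ᴾ : ∀ {X Y} → X ≈ᴾ Y → Fixed Y → Fixed X
  Fixed-≈ᴾ X≈Y fixed h = trans (pointwise X≈Y _) (trans (fixed h) (sym (pointwise X≈Y h)))

  Fixed-scale : ∀ u X → Fixed X → Fixed (scale u X)
  Fixed-scale u X fixed h = trans (⟪scale⟫ u X (T h)) (trans (*-cong refl (fixed h)) (sym (⟪scale⟫ u X h)))

  Fixed-terms : ∀ {X} → All (λ t → σ (proj₂ t) ≡ proj₂ t × χ (proj₂ t) ≈ 1#) X → Fixed X
  Fixed-terms []                        h = refl
  Fixed-terms ((σn≡n , χn≈1) ∷ fixed) h =
    +-cong (*-cong refl (trans (*-cong χn≈1 (reflexive (P.cong h σn≡n))) (*-identityˡ _))) (Fixed-terms fixed h)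

  Fixed-concatMap : ∀ {a} {A : Set a} (g : A → LPoly) xs → (∀ x → Fixed (g x)) → Fixed (concatMap g xs)
  Fixed-concatMap g []       fixed h = refl
  Fixed-concatMap g (x ∷ xs) fixed h = trans (⟪⟫-++ (g x) _ (T h))
    (trans (+-cong (fixed x h) (Fixed-concatMap g xs fixed h)) (sym (⟪⟫-++ (g x) _ h)))

  Fixed-⊗ : ∀ p q → Fixed p → Fixed q → Fixed (p ⊗ q)
  Fixed-⊗ p q p-fixed q-fixed h = begin
    ⟪ p ⊗ q ⟫ (T h)                                            ≈⟨ ⟪⊗⟫ p q (T h) ⟩
    ⟪ p ⟫ (λ n → ⟪ q ⟫ (λ n′ → χ (n ·X n′) * h (σ (n ·X n′))))
      ≈⟨ ⟪⟫-cong p (λ n → ⟪⟫-cong q (λ n′ → trans (*-cong (χ-·X n n′) (reflexive (P.cong h (σ-·X n n′)))) (*-assoc _ _ _))) ⟩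
    ⟪ p ⟫ (λ n → ⟪ q ⟫ (λ n′ → χ n * T (λ m → h (σ n ·X m)) n′))  ≈⟨ ⟪⟫-cong p (λ n → ⟪⟫-*ˡ q (χ n) _) ⟩
    ⟪ p ⟫ (λ n → χ n * ⟪ q ⟫ (T (λ m → h (σ n ·X m))))            ≈⟨ ⟪⟫-cong p (λ n → *-cong refl (q-fixed _)) ⟩
    ⟪ p ⟫ (T (λ m → ⟪ q ⟫ (λ n′ → h (m ·X n′))))                  ≈⟨ p-fixed _ ⟩
    ⟪ p ⟫ (λ m → ⟪ q ⟫ (λ n′ → h (m ·X n′)))                      ≈⟨ sym (⟪⊗⟫ p q h) ⟩
    ⟪ p ⊗ q ⟫ h ∎

  Fixed-one : Fixed one
  Fixed-one = Fixed-terms ((σ-X1 , χ-X1) ∷ [])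

  Fixed-^^ : ∀ p n → Fixed p → Fixed (p ^^ n)
  Fixed-^^ p zero    fixed = Fixed-one
  Fixed-^^ p (suc n) fixed = Fixed-⊗ p (p ^^ n) fixed (Fixed-^^ p n fixed)

  Fixed-powerProduct : ∀ n g es → (∀ i → Fixed (g i)) → Fixed (powerProduct n g es)
  Fixed-powerProduct zero    g []       fixed = Fixed-one
  Fixed-powerProduct (suc n) g (e ∷ es) fixed =
    Fixed-⊗ (g Fin.zero ^^ e) (powerProduct n (λ i → g (Fin.suc i)) es)
      (Fixed-^^ (g Fin.zero) e (fixed Fin.zero)) (Fixed-powerProduct n _ es (λ i → fixed (Fin.suc i)))

  Fixed-θ : (∀ i → Fixed (θz i)) → (∀ p q → Fixed (αβ-cube p q)) → ∀ P → Fixed (θ P)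
  Fixed-θ θz-fixed αβ-fixed P = Fixed-concatMap _ P (λ { (a , (e , p , q)) → Fixed-scale a (θmon (e , p , q)) (θmon-fixed e p q) })
    where
    θmon-fixed : ∀ e p q → Fixed (θmon (e , p , q))
    θmon-fixed e p q rewrite θmon≡ e p q = Fixed-⊗ (powerProduct 10 θz e) (αβ-cube p q) (Fixed-powerProduct 10 θz e θz-fixed) (αβ-fixed p q)

  iterT : ℕ → (XMon → Carrier) → XMon → Carrier
  iterT zero    h = h
  iterT (suc n) h = iterT n (T h)

  iterT-diagonal : (∀ n → σ n ≡ n) → ∀ j H n → iterT j H n ≈ χ n ^ j * H n
  iterT-diagonal σ≡id zero    H n = sym (*-identityˡ _)
  iterT-diagonal σ≡id (suc j) H n = begin
    iterT j (T H) n                 ≈⟨ iterT-diagonal σ≡id j (T H) n ⟩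
    χ n ^ j * (χ n * H (σ n))       ≈⟨ *-cong refl (*-cong refl (reflexive (P.cong H (σ≡id n)))) ⟩
    χ n ^ j * (χ n * H n)           ≈⟨ solve 3 (λ x y z → x :* (y :* z) := (y :* x) :* z) refl _ _ _ ⟩
    χ n * χ n ^ j * H n ∎

  module Realised (E : LPoly → LPoly) (⟪E⟫ : ∀ X h → ⟪ E X ⟫ h ≈ ⟪ X ⟫ (T h)) where

    ⟪iter⟫ : ∀ n X h → ⟪ iter n E X ⟫ h ≈ ⟪ X ⟫ (iterT n h)
    ⟪iter⟫ zero    X h = refl
    ⟪iter⟫ (suc n) X h = trans (⟪E⟫ (iter n E X) h) (⟪iter⟫ n X (T h))

    iter-fixed : ∀ n {X} → Fixed X → iter n E X ≈ᴾ X
    pointwise (iter-fixed zero    fixed) h = refl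
    pointwise (iter-fixed (suc n) fixed) h = trans (⟪E⟫ _ h) (trans (pointwise (iter-fixed n fixed) (T h)) (fixed h))

module HeisenbergAction {c ℓ} (k : CommutativeRing c ℓ) (ζ : CommutativeRing.Carrier k)
  (ζ³≈1 : CommutativeRing._≈_ k (CommutativeRing._*_ k (CommutativeRing._*_ k ζ ζ) ζ) (CommutativeRing.1# k)) where
  open CommutativeRing k
  open Setup k ζ
  open Pairing k ζ
  open CubeRoot k ζ
  open import Relation.Binary.Reasoning.Setoid setoid
  open import Algebra.Solver.Ring.NaturalCoefficients.Default commutativeSemiring

  degree : XMon → ℕ
  degree (e₁ , e₂ , e₃ , _ , _) = e₁ ℕ.+ e₂ ℕ.+ e₃

  -- The exponent of ζ by which E₂₃ scales a monomial.
  weight : XMon → ℤ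
  weight (_ , e₂ , e₃ , _ , b) = + (e₂ ℕ.+ e₂ ℕ.+ e₃) ℤ.+ b

  σ₁₂ : XMon → XMon
  σ₁₂ (e₁ , e₂ , e₃ , a , b) = (e₃ , e₁ , e₂ , a , b)

  χ₁₃ χ₁₂ χ₂₃ : XMon → Carrier
  χ₁₃ m = ζ ^ degree m
  χ₁₂ (_ , _ , _ , a , _) = ζ^ a
  χ₂₃ (_ , e₂ , e₃ , _ , b) = ζ² ^ e₂ * ζ ^ e₃ * ζ^ b

  χ₂₃≈ζ^weight : ∀ m → χ₂₃ m ≈ ζ^ (weight m)
  χ₂₃≈ζ^weight (_ , e₂ , e₃ , _ , b) = begin
    ζ² ^ e₂ * ζ ^ e₃ * ζ^ b               ≈⟨ *-cong (*-cong (trans (pow-* ζ ζ e₂) (sym (pow-+ ζ e₂ e₂))) refl) refl ⟩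
    ζ ^ (e₂ ℕ.+ e₂) * ζ ^ e₃ * ζ^ b       ≈⟨ *-cong (sym (pow-+ ζ (e₂ ℕ.+ e₂) e₃)) refl ⟩
    ζ^ (+ (e₂ ℕ.+ e₂ ℕ.+ e₃)) * ζ^ b      ≈⟨ sym (ζ^-+ ζ³≈1 (+ (e₂ ℕ.+ e₂ ℕ.+ e₃)) b) ⟩
    ζ^ (+ (e₂ ℕ.+ e₂ ℕ.+ e₃) ℤ.+ b) ∎

  degree-·X : ∀ m n → degree (m ·X n) ≡ degree m ℕ.+ degree n
  degree-·X (a₁ , a₂ , a₃ , _ , _) (b₁ , b₂ , b₃ , _ , _) = rearrange a₁ a₂ a₃ b₁ b₂ b₃
    where
    rearrange : ∀ a₁ a₂ a₃ b₁ b₂ b₃ →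
      a₁ ℕ.+ b₁ ℕ.+ (a₂ ℕ.+ b₂) ℕ.+ (a₃ ℕ.+ b₃) ≡ a₁ ℕ.+ a₂ ℕ.+ a₃ ℕ.+ (b₁ ℕ.+ b₂ ℕ.+ b₃)
    rearrange = solve-∀ℕ

  χ₁₃-·X : ∀ m n → χ₁₃ (m ·X n) ≈ χ₁₃ m * χ₁₃ n
  χ₁₃-·X m n = trans (reflexive (P.cong (ζ ^_) (degree-·X m n))) (pow-+ ζ (degree m) (degree n))

  χ₁₂-·X : ∀ m n → χ₁₂ (m ·X n) ≈ χ₁₂ m * χ₁₂ n
  χ₁₂-·X (_ , _ , _ , a , _) (_ , _ , _ , a′ , _) = ζ^-+ ζ³≈1 a a′

  χ₂₃-·X : ∀ m n → χ₂₃ (m ·X n) ≈ χ₂₃ m * χ₂₃ n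
  χ₂₃-·X (_ , a₂ , a₃ , _ , b) (_ , b₂ , b₃ , _ , b′) = trans
    (*-cong (*-cong (pow-+ ζ² a₂ b₂) (pow-+ ζ a₃ b₃)) (ζ^-+ ζ³≈1 b b′))
    (solve 6 (λ x y z u v w → ((x :* u) :* (y :* v)) :* (z :* w) := ((x :* y) :* z) :* ((u :* v) :* w)) refl _ _ _ _ _ _)

  σ₁₂-·X : ∀ m n → σ₁₂ (m ·X n) ≡ σ₁₂ m ·X σ₁₂ n
  σ₁₂-·X (_ , _ , _ , _ , _) (_ , _ , _ , _ , _) = P.refl

  id-·X : ∀ m n → id (m ·X n) ≡ id m ·X id n
  id-·X _ _ = P.refl

  χ₂₃-X1 : χ₂₃ X1 ≈ 1#
  χ₂₃-X1 = trans (*-identityʳ _) (*-identityʳ _)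

  module E₁₃ = MonomialOperator k ζ χ₁₃ id χ₁₃-·X id-·X refl P.refl
  module E₁₂ = MonomialOperator k ζ χ₁₂ σ₁₂ χ₁₂-·X σ₁₂-·X refl P.refl
  module E₂₃ = MonomialOperator k ζ χ₂₃ id χ₂₃-·X id-·X χ₂₃-X1 P.refl

  ⟪actE13⟫ : ∀ X h → ⟪ actE13 X ⟫ h ≈ ⟪ X ⟫ (E₁₃.T h)
  ⟪actE13⟫ X h = trans (reflexive (∑-map _ X _)) (∑-cong X (λ { (_ , (_ , _ , _ , _ , _)) → *-assoc _ _ _ }))

  ⟪actE12⟫ : ∀ X h → ⟪ actE12 X ⟫ h ≈ ⟪ X ⟫ (E₁₂.T h)
  ⟪actE12⟫ X h = trans (reflexive (∑-map _ X _)) (∑-cong X (λ { (_ , (_ , _ , _ , _ , _)) → *-assoc _ _ _ }))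

  ⟪actE23⟫ : ∀ X h → ⟪ actE23 X ⟫ h ≈ ⟪ X ⟫ (E₂₃.T h)
  ⟪actE23⟫ X h = trans (reflexive (∑-map _ X _)) (∑-cong X (λ { (_ , (_ , _ , _ , _ , _)) →
    solve 4 (λ x y z u → ((x :* y) :* z) :* u := x :* ((y :* z) :* u)) refl _ _ _ _ }))

  module E₁₃-act = E₁₃.Realised actE13 ⟪actE13⟫
  module E₁₂-act = E₁₂.Realised actE12 ⟪actE12⟫
  module E₂₃-act = E₂₃.Realised actE23 ⟪actE23⟫

  exponent₁₃ : H → ℕ
  exponent₁₃ (a , b , c) = (toℕ c ℕ.+ 2 ℕ.* toℕ a ℕ.* toℕ b) ℕ.% 3

  T[_] : H → (XMon → Carrier) → XMon → Carrier
  T[ g@(a , b , _) ] h = E₁₃.iterT (exponent₁₃ g) (E₂₃.iterT (toℕ b) (E₁₂.iterT (toℕ a) h))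

  ⟪act⟫ : ∀ g X h → ⟪ act g X ⟫ h ≈ ⟪ X ⟫ (T[ g ] h)
  ⟪act⟫ g@(a , b , _) X h =
    trans (E₁₂-act.⟪iter⟫ (toℕ a) _ h)
   (trans (E₂₃-act.⟪iter⟫ (toℕ b) _ _)
          (E₁₃-act.⟪iter⟫ (exponent₁₃ g) X _))

  act-fixed : ∀ {X} → E₁₃.Fixed X → E₁₂.Fixed X → E₂₃.Fixed X → ∀ g → act g X ≈ᴾ X
  act-fixed {X} fixed₁₃ fixed₁₂ fixed₂₃ g@(a , b , _) =
    ≈ᴾ-trans (E₁₂-act.iter-fixed (toℕ a) (E₁₂.Fixed-≈ᴾ inner≈X fixed₁₂)) inner≈X
    where
    innermost≈X : iter (exponent₁₃ g) actE13 X ≈ᴾ X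
    innermost≈X = E₁₃-act.iter-fixed (exponent₁₃ g) fixed₁₃
    inner≈X : iter (toℕ b) actE23 (iter (exponent₁₃ g) actE13 X) ≈ᴾ X
    inner≈X = ≈ᴾ-trans (E₂₃-act.iter-fixed (toℕ b) (E₂₃.Fixed-≈ᴾ innermost≈X fixed₂₃)) innermost≈X

pattern z₁ = Fin.zero
pattern z₂ = Fin.suc z₁
pattern z₃ = Fin.suc z₂
pattern z₄ = Fin.suc z₃
pattern z₅ = Fin.suc z₄
pattern z₆ = Fin.suc z₅
pattern z₇ = Fin.suc z₆
pattern z₈ = Fin.suc z₇
pattern z₉ = Fin.suc z₈
pattern z₁₀ = Fin.suc z₉

module Orbits {c ℓ} (k : CommutativeRing c ℓ) (ζ : CommutativeRing.Carrier k)
  (ζ³≈1 : CommutativeRing._≈_ k (CommutativeRing._*_ k (CommutativeRing._*_ k ζ ζ) ζ) (CommutativeRing.1# k)) where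
  open CommutativeRing k
  open Setup k ζ
  open Pairing k ζ
  open CubeRoot k ζ
  open HeisenbergAction k ζ ζ³≈1
  open import Relation.Binary.Reasoning.Setoid setoid
  open import Algebra.Solver.Ring.NaturalCoefficients.Default commutativeSemiring

  -- The E₁₂-orbit sum of a monomial, twisted so as to be fixed by E₁₂.
  orbit : XMon → LPoly
  orbit x = (1# , x) ∷ (χ₁₂ x , σ₁₂ x) ∷ (χ₁₂ x * χ₁₂ x , σ₁₂ (σ₁₂ x)) ∷ []

  χ₁₂-cube : ∀ x → χ₁₂ x * χ₁₂ x * χ₁₂ x ≈ 1#
  χ₁₂-cube (_ , _ , _ , a , _) = ζ^-cube ζ³≈1 a

  orbit-fixed : ∀ x → E₁₂.Fixed (orbit x)
  orbit-fixed x@(_ , _ , _ , a , _) h = begin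
    1# * (u * h₁) + (u * (u * h₂) + (u * u * (u * h₀) + 0#))
      ≈⟨ solve 4 (λ u h₀ h₁ h₂ → con 1 :* (u :* h₁) :+ (u :* (u :* h₂) :+ (u :* u :* (u :* h₀) :+ con 0))
                             := (u :* u :* u) :* h₀ :+ (u :* h₁ :+ (u :* u :* h₂ :+ con 0))) refl u h₀ h₁ h₂ ⟩
    (u * u * u) * h₀ + (u * h₁ + (u * u * h₂ + 0#))
      ≈⟨ +-cong (trans (*-cong (χ₁₂-cube x) refl) (*-identityˡ h₀)) refl ⟩
    h₀ + (u * h₁ + (u * u * h₂ + 0#))
      ≈⟨ +-cong (sym (*-identityˡ h₀)) refl ⟩
    1# * h₀ + (u * h₁ + (u * u * h₂ + 0#)) ∎
    where
    u h₀ h₁ h₂ : Carrier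
    u = ζ^ a
    h₀ = h x
    h₁ = h (σ₁₂ x)
    h₂ = h (σ₁₂ (σ₁₂ x))

  orbit-σ₁₂ : ∀ x → orbit (σ₁₂ x) ≈ᴾ scale (χ₁₂ x * χ₁₂ x) (orbit x)
  pointwise (orbit-σ₁₂ x@(_ , _ , _ , a , _)) h = begin
    1# * h₁ + (u * h₂ + (u * u * h₀ + 0#))
      ≈⟨ solve 4 (λ u h₀ h₁ h₂ → con 1 :* h₁ :+ (u :* h₂ :+ (u :* u :* h₀ :+ con 0))
                             := con 1 :* h₁ :+ (con 1 :* u :* h₂ :+ (u :* u :* h₀ :+ con 0))) refl u h₀ h₁ h₂ ⟩
    1# * h₁ + (1# * u * h₂ + (u * u * h₀ + 0#))
      ≈⟨ sym (+-cong (*-cong (χ₁₂-cube x) refl) (+-cong (*-cong (*-cong (χ₁₂-cube x) refl) refl) refl)) ⟩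
    (u * u * u) * h₁ + ((u * u * u) * u * h₂ + (u * u * h₀ + 0#))
      ≈⟨ solve 4 (λ u h₀ h₁ h₂ → (u :* u :* u) :* h₁ :+ ((u :* u :* u) :* u :* h₂ :+ (u :* u :* h₀ :+ con 0))
                             := (u :* u) :* con 1 :* h₀ :+ ((u :* u) :* u :* h₁ :+ ((u :* u) :* (u :* u) :* h₂ :+ con 0))) refl u h₀ h₁ h₂ ⟩
    (u * u) * 1# * h₀ + ((u * u) * u * h₁ + ((u * u) * (u * u) * h₂ + 0#)) ∎
    where
    u h₀ h₁ h₂ : Carrier
    u = ζ^ a
    h₀ = h x
    h₁ = h (σ₁₂ x)
    h₂ = h (σ₁₂ (σ₁₂ x))

  lead : Fin 9 → XMon
  lead z₁ = mon 3 0 0 (+ 0) (+ 0)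
  lead z₂ = mon 3 0 0 (+ 2) (+ 0)
  lead z₃ = mon 3 0 0 (+ 1) (+ 0)
  lead z₄ = mon 2 0 1 (+ 0) (+ 2)
  lead z₅ = mon 2 0 1 (+ 2) (+ 2)
  lead z₆ = mon 2 0 1 (+ 1) (+ 2)
  lead z₇ = mon 2 1 0 (+ 0) (+ 1)
  lead z₈ = mon 2 1 0 (+ 2) (+ 1)
  lead z₉ = mon 2 1 0 (+ 1) (+ 1)

  coefficientwise : ∀ {a₁ a₂ a₃ b₁ b₂ b₃ m₁ m₂ m₃} → a₁ ≈ b₁ → a₂ ≈ b₂ → a₃ ≈ b₃ →
    (a₁ , m₁) ∷ (a₂ , m₂) ∷ (a₃ , m₃) ∷ [] ≈ᴾ (b₁ , m₁) ∷ (b₂ , m₂) ∷ (b₃ , m₃) ∷ []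
  pointwise (coefficientwise a₁≈b₁ a₂≈b₂ a₃≈b₃) h =
    +-cong (*-cong a₁≈b₁ refl) (+-cong (*-cong a₂≈b₂ refl) (+-cong (*-cong a₃≈b₃ refl) refl))

  -- The coefficients of the generators twisted by α^j, as multiples of ζ ^ j.
  twist₀ : ∀ {m₁ m₂ m₃} → (1# , m₁) ∷ (1# , m₂) ∷ (1# , m₃) ∷ [] ≈ᴾ (1# * 1# , m₁) ∷ (1# * 1# , m₂) ∷ (1# * (1# * 1#) , m₃) ∷ []
  twist₀ = coefficientwise (sym (*-identityˡ _)) (sym (*-identityˡ _)) (sym (trans (*-identityˡ _) (*-identityˡ _)))

  twist₁ : ∀ {m₁ m₂ m₃} → (ζ , m₁) ∷ (ζ² , m₂) ∷ (1# , m₃) ∷ [] ≈ᴾ (ζ ^ 1 * 1# , m₁) ∷ (ζ ^ 1 * ζ ^ 1 , m₂) ∷ (ζ ^ 1 * (ζ ^ 1 * ζ ^ 1) , m₃) ∷ []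
  twist₁ = coefficientwise
    (solve 1 (λ z → z := z :* con 1 :* con 1) refl ζ)
    (solve 1 (λ z → z :* z := z :* con 1 :* (z :* con 1)) refl ζ)
    (sym (trans (solve 1 (λ z → z :* con 1 :* (z :* con 1 :* (z :* con 1)) := z :* z :* z) refl ζ) ζ³≈1))

  twist₂ : ∀ {m₁ m₂ m₃} → (ζ² , m₁) ∷ (ζ , m₂) ∷ (1# , m₃) ∷ [] ≈ᴾ (ζ ^ 2 * 1# , m₁) ∷ (ζ ^ 2 * ζ ^ 2 , m₂) ∷ (ζ ^ 2 * (ζ ^ 2 * ζ ^ 2) , m₃) ∷ []
  twist₂ = coefficientwise
    (solve 1 (λ z → z :* z := z :* (z :* con 1) :* con 1) refl ζ)
    (sym (trans (solve 1 (λ z → z :* (z :* con 1) :* (z :* (z :* con 1)) := (z :* z :* z) :* z) refl ζ)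
                (trans (*-cong ζ³≈1 refl) (*-identityˡ ζ))))
    (sym (trans (solve 1 (λ z → z :* (z :* con 1) :* (z :* (z :* con 1) :* (z :* (z :* con 1))) := (z :* z :* z) :* (z :* z :* z)) refl ζ)
                (trans (*-cong ζ³≈1 ζ³≈1) (*-identityˡ 1#))))

  generator≈orbit : ∀ j → θz (inject₁ j) ≈ᴾ scale (χ₁₂ (lead j)) (orbit (lead j))
  generator≈orbit z₁ = twist₀
  generator≈orbit z₂ = twist₂
  generator≈orbit z₃ = twist₁
  generator≈orbit z₄ = twist₀
  generator≈orbit z₅ = twist₂
  generator≈orbit z₆ = twist₁
  generator≈orbit z₇ = twist₀
  generator≈orbit z₈ = twist₂
  generator≈orbit z₉ = twist₁

  generators-cubic : ∀ i → All (λ t → degree (proj₂ t) ≡ 3) (θz i)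
  generators-cubic = from-yes (all? λ i → All.all? (λ t → degree (proj₂ t) ℕ.≟ 3) (θz i))

  generators-weight : ∀ i → All (λ t → weight (proj₂ t) ℤD.%ℕ 3 ≡ 0) (θz i)
  generators-weight = from-yes (all? λ i → All.all? (λ t → weight (proj₂ t) ℤD.%ℕ 3 ℕ.≟ 0) (θz i))

  θz-fixed₁₃ : ∀ i → E₁₃.Fixed (θz i)
  θz-fixed₁₃ i = E₁₃.Fixed-terms (All.map (λ d → P.refl , trans (reflexive (P.cong (ζ ^_) d)) (ζ^3≈1 ζ³≈1))
                                            (generators-cubic i))

  θz-fixed₂₃ : ∀ i → E₂₃.Fixed (θz i)
  θz-fixed₂₃ i = E₂₃.Fixed-terms (All.map (λ {t} w → P.refl , trans (χ₂₃≈ζ^weight (proj₂ t)) (ζ^-periodic ζ³≈1 (weight (proj₂ t)) w))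
                                            (generators-weight i))

  θz-fixed₁₂ : ∀ i → E₁₂.Fixed (θz i)
  θz-fixed₁₂ i with view i
  ... | ‵fromℕ      = E₁₂.Fixed-terms ((P.refl , refl) ∷ [])
  ... | ‵inj₁ {i = j} _ = E₁₂.Fixed-≈ᴾ (generator≈orbit j) (E₁₂.Fixed-scale _ (orbit (lead j)) (orbit-fixed (lead j)))

  image⇒invariant : ∀ f → Image f → Invariant f
  image⇒invariant f (P , θP≋f) g = ≈ᴾ⇒≋ (act-fixed
    (E₁₃.Fixed-≈ᴾ f≈θP (E₁₃.Fixed-θ θz-fixed₁₃ (λ p q → E₁₃.Fixed-terms ((P.refl , refl) ∷ [])) P))
    (E₁₂.Fixed-≈ᴾ f≈θP (E₁₂.Fixed-θ θz-fixed₁₂ (λ p q → E₁₂.Fixed-terms ((P.refl , ζ^[3*q]≈1 ζ³≈1 p) ∷ [])) P))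
    (E₂₃.Fixed-≈ᴾ f≈θP (E₂₃.Fixed-θ θz-fixed₂₃ (λ p q → E₂₃.Fixed-terms ((P.refl , αβ-weight q) ∷ [])) P))
    g)
    where
    f≈θP : f ≈ᴾ θ P
    f≈θP = ≋⇒≈ᴾ (λ m → sym (θP≋f m))
    αβ-weight : ∀ q → 1# * 1# * ζ^ (+ 3 ℤ.* q) ≈ 1#
    αβ-weight q = trans (*-cong (*-identityʳ 1#) (ζ^[3*q]≈1 ζ³≈1 q)) (*-identityʳ 1#)

module ImageClosure {c ℓ} (k : CommutativeRing c ℓ) (ζ : CommutativeRing.Carrier k) where
  open CommutativeRing k
  open Setup k ζ
  open Pairing k ζ
  open MonomialProducts k ζ

  InImage : LPoly → Set (c ⊔ ℓ)
  InImage X = Σ ZPoly λ P → X ≈ᴾ θ P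

  scaleZ : Carrier → ZPoly → ZPoly
  scaleZ u = map (map₁ (u *_))

  θ-scaleZ : ∀ u P → θ (scaleZ u P) ≈ᴾ scale u (θ P)
  θ-scaleZ u []            = ≈ᴾ-refl
  θ-scaleZ u ((a , m) ∷ P) = begin
    scale (u * a) (θmon m) ++ θ (scaleZ u P)         ≈⟨ ++-cong (≈ᴾ-sym (scale-* u a (θmon m))) (θ-scaleZ u P) ⟩
    scale u (scale a (θmon m)) ++ scale u (θ P)      ≡⟨ P.sym (map-++ _ (scale a (θmon m)) (θ P)) ⟩
    scale u (scale a (θmon m) ++ θ P) ∎
    where open ≈ᴾ-Reasoning

  InImage-[] : InImage []
  InImage-[] = [] , ≈ᴾ-refl

  InImage-≈ᴾ : ∀ {X Y} → X ≈ᴾ Y → InImage Y → InImage X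
  InImage-≈ᴾ X≈Y (P , Y≈θP) = P , ≈ᴾ-trans X≈Y Y≈θP

  InImage-++ : ∀ {X Y} → InImage X → InImage Y → InImage (X ++ Y)
  InImage-++ (P , X≈θP) (Q , Y≈θQ) =
    P ++ Q , ≈ᴾ-trans (++-cong X≈θP Y≈θQ) (≈ᴾ-reflexive (P.sym (concatMap-++ _ P Q)))

  InImage-concatMap : ∀ {a} {A : Set a} (g : A → LPoly) {xs} → All (λ x → InImage (g x)) xs → InImage (concatMap g xs)
  InImage-concatMap g []         = InImage-[]
  InImage-concatMap g (im ∷ ims) = InImage-++ im (InImage-concatMap g ims)

  InImage-scale : ∀ u {X} → InImage X → InImage (scale u X)
  InImage-scale u (P , X≈θP) = scaleZ u P , ≈ᴾ-trans (scale-congʳ u X≈θP) (≈ᴾ-sym (θ-scaleZ u P))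

  powerProduct-zeros : ∀ n g {es} → es ≡ replicate n 0 → powerProduct n g es ≈ᴾ one
  powerProduct-zeros zero    g P.refl = ≈ᴾ-refl
  powerProduct-zeros (suc n) g P.refl = ≈ᴾ-trans (one-⊗ _) (powerProduct-zeros n (λ i → g (Fin.suc i)) P.refl)

  θmon-zeros : ∀ e p q → e ≡ replicate 10 0 → θmon (e , p , q) ≈ᴾ αβ-cube p q
  θmon-zeros e p q e≡0 = begin
    θmon (e , p , q)                      ≡⟨ θmon≡ e p q ⟩
    powerProduct 10 θz e ⊗ αβ-cube p q    ≈⟨ ⊗-congˡ (αβ-cube p q) (powerProduct-zeros 10 θz e≡0) ⟩
    one ⊗ αβ-cube p q                     ≈⟨ one-⊗ (αβ-cube p q) ⟩
    αβ-cube p q ∎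
    where open ≈ᴾ-Reasoning

  θ-singleton : ∀ m → θ ((1# , m) ∷ []) ≈ᴾ θmon m
  θ-singleton m = ≈ᴾ-trans (++-cong (scale-1 (θmon m) refl) ≈ᴾ-refl) (≈ᴾ-reflexive (++-identityʳ (θmon m)))

  -- Abstract, since normalising θmon at the zero exponent vector is prohibitively slow.
  abstract
    zeros : Vec ℕ 10
    zeros = replicate 10 0

    zeros≡ : zeros ≡ replicate 10 0
    zeros≡ = P.refl

  InImage-αβ-cube : ∀ p q → InImage (αβ-cube p q)
  InImage-αβ-cube p q = (1# , (zeros , p , q)) ∷ [] ,
    ≈ᴾ-sym (≈ᴾ-trans (θ-singleton (zeros , p , q)) (θmon-zeros zeros p q zeros≡))

  powerProduct-updateAt : ∀ n g (i : Fin n) es →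
    powerProduct n g (updateAt es i suc) ≈ᴾ g i ⊗ powerProduct n g es
  powerProduct-updateAt (suc n) g Fin.zero    (e ∷ es) = ⊗-assoc (g Fin.zero) (g Fin.zero ^^ e) _
  powerProduct-updateAt (suc n) g (Fin.suc i) (e ∷ es) = begin
    G ⊗ powerProduct n g′ (updateAt es i suc)     ≈⟨ ⊗-congʳ G (powerProduct-updateAt n g′ i es) ⟩
    G ⊗ (g′ i ⊗ R)                                ≈⟨ ≈ᴾ-sym (⊗-assoc G (g′ i) R) ⟩
    (G ⊗ g′ i) ⊗ R                                ≈⟨ ⊗-congˡ R (⊗-comm G (g′ i)) ⟩
    (g′ i ⊗ G) ⊗ R                                ≈⟨ ⊗-assoc (g′ i) G R ⟩
    g′ i ⊗ (G ⊗ R) ∎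
    where
    open ≈ᴾ-Reasoning
    g′ : Fin n → LPoly
    g′ i = g (Fin.suc i)
    G R : LPoly
    G = g Fin.zero ^^ e
    R = powerProduct n g′ es

  θmon-updateAt : ∀ i e p q → θmon (updateAt e i suc , p , q) ≈ᴾ θz i ⊗ θmon (e , p , q)
  θmon-updateAt i e p q = begin
    θmon (updateAt e i suc , p , q)                           ≡⟨ θmon≡ (updateAt e i suc) p q ⟩
    powerProduct 10 θz (updateAt e i suc) ⊗ αβ-cube p q       ≈⟨ ⊗-congˡ _ (powerProduct-updateAt 10 θz i e) ⟩
    (θz i ⊗ powerProduct 10 θz e) ⊗ αβ-cube p q               ≈⟨ ⊗-assoc (θz i) _ _ ⟩
    θz i ⊗ (powerProduct 10 θz e ⊗ αβ-cube p q)               ≡⟨ P.cong (θz i ⊗_) (P.sym (θmon≡ e p q)) ⟩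
    θz i ⊗ θmon (e , p , q) ∎
    where open ≈ᴾ-Reasoning

  θ-map-updateAt : ∀ i P → θ (map (map₂ (map₁ (λ e → updateAt e i suc))) P) ≈ᴾ θz i ⊗ θ P
  θ-map-updateAt i []                    = ≈ᴾ-sym (⊗-[] (θz i))
  θ-map-updateAt i ((a , (e , p , q)) ∷ P) = begin
    scale a (θmon (updateAt e i suc , p , q)) ++ θ (map _ P)   ≈⟨ ++-cong (scale-congʳ a (θmon-updateAt i e p q)) (θ-map-updateAt i P) ⟩
    scale a (θz i ⊗ θmon (e , p , q)) ++ θz i ⊗ θ P            ≈⟨ ++-cong (≈ᴾ-sym (⊗-scale a (θz i) _)) ≈ᴾ-refl ⟩
    θz i ⊗ scale a (θmon (e , p , q)) ++ θz i ⊗ θ P            ≈⟨ ≈ᴾ-sym (⊗-++ (θz i) _ (θ P)) ⟩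
    θz i ⊗ (scale a (θmon (e , p , q)) ++ θ P) ∎
    where open ≈ᴾ-Reasoning

  InImage-θz-⊗ : ∀ i {X} → InImage X → InImage (θz i ⊗ X)
  InImage-θz-⊗ i {X} (P , X≈θP) =
    map (map₂ (map₁ (λ e → updateAt e i suc))) P , ≈ᴾ-trans (⊗-congʳ (θz i) X≈θP) (≈ᴾ-sym (θ-map-updateAt i P))

  Multiplier : LPoly → Set (c ⊔ ℓ)
  Multiplier X = ∀ Y → InImage Y → InImage (X ⊗ Y)

  Multiplier-[] : Multiplier []
  Multiplier-[] _ _ = InImage-[]

  Multiplier-≈ᴾ : ∀ {X X′} → X ≈ᴾ X′ → Multiplier X′ → Multiplier X
  Multiplier-≈ᴾ X≈X′ mult Y imY = InImage-≈ᴾ (⊗-congˡ Y X≈X′) (mult Y imY)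

  Multiplier-scale : ∀ u {X} → Multiplier X → Multiplier (scale u X)
  Multiplier-scale u {X} mult Y imY = InImage-≈ᴾ (scale-⊗ u X Y) (InImage-scale u (mult Y imY))

  Multiplier-θz : ∀ u i → Multiplier (scale u (θz i))
  Multiplier-θz u i = Multiplier-scale u {θz i} (λ _ → InImage-θz-⊗ i)

pattern r₀ = Fin.zero
pattern r₁ = Fin.suc r₀
pattern r₂ = Fin.suc r₁

module ProductFormula {c ℓ} (k : CommutativeRing c ℓ) (ζ : CommutativeRing.Carrier k)
  (ζ³≈1 : CommutativeRing._≈_ k (CommutativeRing._*_ k (CommutativeRing._*_ k ζ ζ) ζ) (CommutativeRing.1# k))
  (cubeSum-ζ≈0 : CommutativeRing._≈_ k (CubeRoot.cubeSum k ζ ζ) (CommutativeRing.0# k)) where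
  open CommutativeRing k
  open Setup k ζ
  open Pairing k ζ
  open CubeRoot k ζ
  open HeisenbergAction k ζ ζ³≈1
  open Orbits k ζ ζ³≈1
  open import Algebra.Solver.Ring.NaturalCoefficients.Default commutativeSemiring

  three : Carrier
  three = 1# + 1# + 1#

  I₃ : List (Fin 3)
  I₃ = r₀ ∷ r₁ ∷ r₂ ∷ []

  power : Fin 3 → Carrier → Carrier
  power r₀ u = 1#
  power r₁ u = u
  power r₂ u = u * u

  rotation : Fin 3 → XMon → XMon
  rotation r₀ x = x
  rotation r₁ x = σ₁₂ x
  rotation r₂ x = σ₁₂ (σ₁₂ x)

  power-cong : ∀ r {u v} → u ≈ v → power r u ≈ power r v
  power-cong r₀ u≈v = refl
  power-cong r₁ u≈v = u≈v
  power-cong r₂ u≈v = *-cong u≈v u≈v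

  power-* : ∀ r u v → power r (u * v) ≈ power r u * power r v
  power-* r₀ u v = sym (*-identityˡ _)
  power-* r₁ u v = refl
  power-* r₂ u v = solve 2 (λ x y → (x :* y) :* (x :* y) := (x :* x) :* (y :* y)) refl u v

  power≈pow : ∀ r n → power r (ζ ^ n) ≈ ζ ^ (toℕ r ℕ.* n)
  power≈pow r₀ n = refl
  power≈pow r₁ n = reflexive (P.cong (ζ ^_) (P.sym (ℕP.+-identityʳ n)))
  power≈pow r₂ n = trans (sym (pow-+ ζ n n)) (reflexive (P.cong (λ m → ζ ^ (n ℕ.+ m)) (P.sym (ℕP.+-identityʳ n))))

  ζ^-neg : ∀ n → ζ^ (ℤ.- (+ n)) ≈ ζ ^ (n ℕ.+ n)
  ζ^-neg zero    = refl
  ζ^-neg (suc m) = trans (pow-* ζ ζ (suc m)) (sym (pow-+ ζ (suc m) (suc m)))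

  shift : ℤ → XMon → XMon
  shift j (e₁ , e₂ , e₃ , a , b) = (e₁ , e₂ , e₃ , a ℤ.+ j , b)

  χ₁₂-shift : ∀ j x → χ₁₂ (shift j x) ≈ χ₁₂ x * ζ^ j
  χ₁₂-shift j (_ , _ , _ , a , _) = ζ^-+ ζ³≈1 a j

  rotation-shift : ∀ r j x → rotation r (shift j x) ≡ shift j (rotation r x)
  rotation-shift r₀ j x                   = P.refl
  rotation-shift r₁ j (_ , _ , _ , _ , _) = P.refl
  rotation-shift r₂ j (_ , _ , _ , _ , _) = P.refl

  shift-cancel : ∀ j x y → shift j x ·X shift (ℤ.- j) y ≡ x ·X y
  shift-cancel j (e₁ , e₂ , e₃ , a , b) (f₁ , f₂ , f₃ , a′ , b′) =
    P.cong (λ A → (e₁ ℕ.+ f₁ , e₂ ℕ.+ f₂ , e₃ ℕ.+ f₃ , A , b ℤ.+ b′)) (cancel a a′ j)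
    where
    cancel : ∀ a a′ j → (a ℤ.+ j) ℤ.+ (a′ ℤ.+ ℤ.- j) ≡ a ℤ.+ a′
    cancel = solve-∀

  rotation-·X : ∀ r x y → rotation r (x ·X y) ≡ rotation r x ·X rotation r y
  rotation-·X r₀ x y = P.refl
  rotation-·X r₁ (_ , _ , _ , _ , _) (_ , _ , _ , _ , _) = P.refl
  rotation-·X r₂ (_ , _ , _ , _ , _) (_ , _ , _ , _ , _) = P.refl

  ⟪orbit⊗orbit⟫ : ∀ x y h → ⟪ orbit x ⊗ orbit y ⟫ h ≈
    ∑ I₃ (λ r → ∑ I₃ (λ s → (power r (χ₁₂ x) * power s (χ₁₂ y)) * h (rotation r x ·X rotation s y)))
  ⟪orbit⊗orbit⟫ x y h = begin
    ⟪ orbit x ⊗ orbit y ⟫ h                                          ≈⟨ ⟪⊗⟫ (orbit x) (orbit y) h ⟩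
    ∑ I₃ (λ r → power r (χ₁₂ x) * ∑ I₃ (λ s → power s (χ₁₂ y) * h (rotation r x ·X rotation s y)))
      ≈⟨ ∑-cong I₃ (λ r → trans (sym (∑-*ˡ I₃ (power r (χ₁₂ x)) (λ s → power s (χ₁₂ y) * term r s)))
                                (∑-cong I₃ (λ s → sym (*-assoc (power r (χ₁₂ x)) (power s (χ₁₂ y)) (term r s))))) ⟩
    ∑ I₃ (λ r → ∑ I₃ (λ s → (power r (χ₁₂ x) * power s (χ₁₂ y)) * h (rotation r x ·X rotation s y))) ∎
    where
    open ≈-Reasoning
    term : Fin 3 → Fin 3 → Carrier
    term r s = h (rotation r x ·X rotation s y)

  J : List ℕ
  J = 0 ∷ 1 ∷ 2 ∷ []

  character : Fin 3 → Fin 3 → ℕ → Carrier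
  character r s n = power r (ζ^ (+ n)) * power s (ζ^ (ℤ.- (+ n)))

  character≈ : ∀ r s n → character r s n ≈ ζ ^ ((toℕ r ℕ.* n ℕ.+ toℕ s ℕ.* (n ℕ.+ n)) ℕ.% 3)
  character≈ r s n = trans (*-cong (power≈pow r n) (trans (power-cong s (ζ^-neg n)) (power≈pow s (n ℕ.+ n))))
                           (trans (sym (pow-+ ζ (toℕ r ℕ.* n) (toℕ s ℕ.* (n ℕ.+ n)))) (ζ^ℕ-mod ζ³≈1 (toℕ r ℕ.* n ℕ.+ toℕ s ℕ.* (n ℕ.+ n))))

  δ₃ : Fin 3 → Fin 3 → Carrier
  δ₃ r₀ r₀ = three
  δ₃ r₁ r₁ = three
  δ₃ r₂ r₂ = three
  δ₃ _  _  = 0#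

  orthogonality : ∀ r s → ∑ J (character r s) ≈ δ₃ r s
  orthogonality r s = trans (∑-cong J (character≈ r s)) (by-residues r s)
    where
    trivial : ζ ^ 0 + (ζ ^ 0 + (ζ ^ 0 + 0#)) ≈ three
    trivial = solve 0 (con 1 :+ (con 1 :+ (con 1 :+ con 0)) := con 1 :+ con 1 :+ con 1) refl
    ascending : ζ ^ 0 + (ζ ^ 1 + (ζ ^ 2 + 0#)) ≈ 0#
    ascending = trans (solve 1 (λ z → con 1 :+ (z :* con 1 :+ (z :* (z :* con 1) :+ con 0)) := con 1 :+ z :+ z :* z) refl ζ) cubeSum-ζ≈0
    descending : ζ ^ 0 + (ζ ^ 2 + (ζ ^ 1 + 0#)) ≈ 0#
    descending = trans (solve 1 (λ z → con 1 :+ (z :* (z :* con 1) :+ (z :* con 1 :+ con 0)) := con 1 :+ z :+ z :* z) refl ζ) cubeSum-ζ≈0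
    by-residues : ∀ r s → ∑ J (λ n → ζ ^ ((toℕ r ℕ.* n ℕ.+ toℕ s ℕ.* (n ℕ.+ n)) ℕ.% 3)) ≈ δ₃ r s
    by-residues r₀ r₀ = trivial
    by-residues r₀ r₁ = descending
    by-residues r₀ r₂ = ascending
    by-residues r₁ r₀ = ascending
    by-residues r₁ r₁ = trivial
    by-residues r₁ r₂ = descending
    by-residues r₂ r₀ = descending
    by-residues r₂ r₁ = ascending
    by-residues r₂ r₂ = trivial

  shiftedProducts : XMon → XMon → LPoly
  shiftedProducts x y = concatMap (λ n → orbit (shift (+ n) x) ⊗ orbit (shift (ℤ.- (+ n)) y)) J

  -- Summing over the three opposite α-shifts keeps exactly the terms rotated
  -- equally in both factors, by orthogonality of the characters of ℤ/3.
  product-formula : ∀ x y → shiftedProducts x y ≈ᴾ scale three (orbit (x ·X y))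
  pointwise (product-formula x y) h = begin
    ⟪ shiftedProducts x y ⟫ h
      ≈⟨ ∑-concatMap (λ n → orbit (shift (+ n) x) ⊗ orbit (shift (ℤ.- (+ n)) y)) J (λ t → proj₁ t * h (proj₂ t)) ⟩
    ∑ J (λ n → ⟪ orbit (shift (+ n) x) ⊗ orbit (shift (ℤ.- (+ n)) y) ⟫ h)
      ≈⟨ ∑-cong J (λ n → trans (⟪orbit⊗orbit⟫ (shift (+ n) x) (shift (ℤ.- (+ n)) y) h) (∑-cong I₃ (λ r → ∑-cong I₃ (λ s → shifted-term n r s)))) ⟩
    ∑ J (λ n → ∑ I₃ (λ r → ∑ I₃ (λ s → G r s * character r s n)))
      ≈⟨ ∑-swap J I₃ (λ n r → ∑ I₃ (λ s → G r s * character r s n)) ⟩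
    ∑ I₃ (λ r → ∑ J (λ n → ∑ I₃ (λ s → G r s * character r s n)))
      ≈⟨ ∑-cong I₃ (λ r → ∑-swap J I₃ (λ n s → G r s * character r s n)) ⟩
    ∑ I₃ (λ r → ∑ I₃ (λ s → ∑ J (λ n → G r s * character r s n)))
      ≈⟨ ∑-cong I₃ (λ r → ∑-cong I₃ (λ s → trans (∑-*ˡ J (G r s) (character r s)) (*-cong refl (orthogonality r s)))) ⟩
    ∑ I₃ (λ r → ∑ I₃ (λ s → G r s * δ₃ r s))
      ≈⟨ ∑-cong I₃ diagonal ⟩
    ∑ I₃ (λ r → three * G r r)
      ≈⟨ ∑-*ˡ I₃ three (λ r → G r r) ⟩
    three * ∑ I₃ (λ r → G r r)
      ≈⟨ *-cong refl (∑-cong I₃ (λ r → sym (orbit-term r))) ⟩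
    three * ⟪ orbit (x ·X y) ⟫ h
      ≈⟨ sym (⟪scale⟫ three (orbit (x ·X y)) h) ⟩
    ⟪ scale three (orbit (x ·X y)) ⟫ h ∎
    where
    open ≈-Reasoning
    G : Fin 3 → Fin 3 → Carrier
    G r s = (power r (χ₁₂ x) * power s (χ₁₂ y)) * h (rotation r x ·X rotation s y)
    shifted-term : ∀ n r s →
      (power r (χ₁₂ (shift (+ n) x)) * power s (χ₁₂ (shift (ℤ.- (+ n)) y))) *
        h (rotation r (shift (+ n) x) ·X rotation s (shift (ℤ.- (+ n)) y))
      ≈ G r s * character r s n
    shifted-term n r s = trans
      (*-cong (*-cong (trans (power-cong r (χ₁₂-shift (+ n) x)) (power-* r _ _))
                      (trans (power-cong s (χ₁₂-shift (ℤ.- (+ n)) y)) (power-* s _ _)))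
              (reflexive (P.cong h (P.trans (P.cong₂ _·X_ (rotation-shift r (+ n) x) (rotation-shift s (ℤ.- (+ n)) y))
                                            (shift-cancel (+ n) (rotation r x) (rotation s y))))))
      (solve 5 (λ a b u v w → ((a :* b) :* (u :* v)) :* w := ((a :* u) :* w) :* (b :* v)) refl _ _ _ _ _)
    diagonal : ∀ r → ∑ I₃ (λ s → G r s * δ₃ r s) ≈ three * G r r
    diagonal r₀ = solve 4 (λ a b d t → a :* t :+ (b :* con 0 :+ (d :* con 0 :+ con 0)) := t :* a) refl _ _ _ three
    diagonal r₁ = solve 4 (λ a b d t → b :* con 0 :+ (a :* t :+ (d :* con 0 :+ con 0)) := t :* a) refl _ _ _ three
    diagonal r₂ = solve 4 (λ a b d t → b :* con 0 :+ (d :* con 0 :+ (a :* t :+ con 0)) := t :* a) refl _ _ _ three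
    orbit-term : ∀ r → power r (χ₁₂ (x ·X y)) * h (rotation r (x ·X y)) ≈ G r r
    orbit-term r = *-cong (trans (power-cong r (χ₁₂-·X x y)) (power-* r _ _)) (reflexive (P.cong h (rotation-·X r x y)))

module OrbitsInImage {c ℓ} (k : CommutativeRing c ℓ) (ζ : CommutativeRing.Carrier k)
  (ζ³≈1 : CommutativeRing._≈_ k (CommutativeRing._*_ k (CommutativeRing._*_ k ζ ζ) ζ) (CommutativeRing.1# k))
  (cubeSum-ζ≈0 : CommutativeRing._≈_ k (CubeRoot.cubeSum k ζ ζ) (CommutativeRing.0# k))
  (1≉0 : ¬ CommutativeRing._≈_ k (CommutativeRing.1# k) (CommutativeRing.0# k))
  (t₃ : CommutativeRing.Carrier k)
  (t₃*3≈1 : CommutativeRing._≈_ k (CommutativeRing._*_ k t₃ (ProductFormula.three k ζ ζ³≈1 cubeSum-ζ≈0)) (CommutativeRing.1# k)) where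
  open CommutativeRing k
  open Setup k ζ
  open Pairing k ζ
  open CubeRoot k ζ
  open HeisenbergAction k ζ ζ³≈1
  open Orbits k ζ ζ³≈1
  open ImageClosure k ζ
  open ProductFormula k ζ ζ³≈1 cubeSum-ζ≈0
  open import Algebra.Solver.Ring.NaturalCoefficients.Default commutativeSemiring

  cubeSum-cong : ∀ {x y} → x ≈ y → cubeSum x ≈ cubeSum y
  cubeSum-cong x≈y = +-cong (+-cong refl x≈y) (*-cong x≈y x≈y)

  cubeSum-1 : cubeSum 1# ≈ three
  cubeSum-1 = +-cong refl (*-identityʳ 1#)

  orbit-of-fixed : ∀ x → σ₁₂ x ≡ x → orbit x ≈ᴾ scale (cubeSum (χ₁₂ x)) ((1# , x) ∷ [])
  pointwise (orbit-of-fixed x σx≡x) h =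
    trans (+-cong refl (+-cong (*-cong refl (reflexive (P.cong h σx≡x)))
                               (+-cong (*-cong refl (reflexive (P.cong h (P.trans (P.cong σ₁₂ σx≡x) σx≡x)))) refl)))
    (solve 2 (λ u e → con 1 :* e :+ (u :* e :+ (u :* u :* e :+ con 0)) := (con 1 :+ u :+ u :* u) :* con 1 :* e :+ con 0)
          refl (χ₁₂ x) (h x))

  orbit≈generator : ∀ j → orbit (lead j) ≈ᴾ scale (χ₁₂ (lead j) * χ₁₂ (lead j)) (θz (inject₁ j))
  orbit≈generator j = begin
    orbit (lead j)                           ≈⟨ ≈ᴾ-sym (scale-1 (orbit (lead j)) (χ₁₂-cube (lead j))) ⟩
    scale (u * u * u) (orbit (lead j))       ≈⟨ ≈ᴾ-sym (scale-* (u * u) u (orbit (lead j))) ⟩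
    scale (u * u) (scale u (orbit (lead j))) ≈⟨ scale-congʳ (u * u) (≈ᴾ-sym (generator≈orbit j)) ⟩
    scale (u * u) (θz (inject₁ j)) ∎
    where
    open ≈ᴾ-Reasoning
    u : Carrier
    u = χ₁₂ (lead j)

  ShiftMultipliers : XMon → Set (c ⊔ ℓ)
  ShiftMultipliers u = All (λ n → Multiplier (orbit (shift (+ n) u))) J

  lead-multiplier : ∀ j → Multiplier (orbit (lead j))
  lead-multiplier j = Multiplier-≈ᴾ (orbit≈generator j) (Multiplier-θz _ (inject₁ j))

  ShiftMultipliers-σ₁₂ : ∀ u → ShiftMultipliers u → ShiftMultipliers (σ₁₂ u)
  ShiftMultipliers-σ₁₂ u@(_ , _ , _ , _ , _) = All.map (λ {n} mult →
    Multiplier-≈ᴾ (orbit-σ₁₂ (shift (+ n) u)) (Multiplier-scale _ {orbit (shift (+ n) u)} mult))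

  multipliers-x₁³ : ShiftMultipliers (mon 3 0 0 (+ 0) (+ 0))
  multipliers-x₁³ = lead-multiplier z₁ ∷ lead-multiplier z₃ ∷ lead-multiplier z₂ ∷ []

  multipliers-x₁²x₃ : ShiftMultipliers (mon 2 0 1 (+ 0) (+ 2))
  multipliers-x₁²x₃ = lead-multiplier z₄ ∷ lead-multiplier z₆ ∷ lead-multiplier z₅ ∷ []

  multipliers-x₁²x₂ : ShiftMultipliers (mon 2 1 0 (+ 0) (+ 1))
  multipliers-x₁²x₂ = lead-multiplier z₇ ∷ lead-multiplier z₉ ∷ lead-multiplier z₈ ∷ []

  multipliers-x₁x₂x₃ : ShiftMultipliers (mon 1 1 1 (+ 0) (+ 0))
  multipliers-x₁x₂x₃ =
    Multiplier-≈ᴾ (≈ᴾ-trans (orbit-of-fixed (mon 1 1 1 (+ 0) (+ 0)) P.refl) (scale-congˡ _ cubeSum-1)) (Multiplier-θz three z₁₀) ∷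
    Multiplier-≈ᴾ (≈ᴾ-trans (orbit-of-fixed (mon 1 1 1 (+ 1) (+ 0)) P.refl) (scale-0 _ (cubeSum-ζ^1 ζ³≈1 cubeSum-ζ≈0))) Multiplier-[] ∷
    Multiplier-≈ᴾ (≈ᴾ-trans (orbit-of-fixed (mon 1 1 1 (+ 2) (+ 0)) P.refl) (scale-0 _ (cubeSum-ζ^2 ζ³≈1 cubeSum-ζ≈0))) Multiplier-[] ∷ []

  record CubicFactor (u : XMon) : Set (c ⊔ ℓ) where
    constructor cubicFactor
    field
      multipliers : ShiftMultipliers u
      degree≡3    : degree u ≡ 3
      weight≡0    : weight u ℤD.%ℕ 3 ≡ 0

  rotate : (f : Σ XMon CubicFactor) →
           degree (σ₁₂ (proj₁ f)) ≡ 3 → weight (σ₁₂ (proj₁ f)) ℤD.%ℕ 3 ≡ 0 → Σ XMon CubicFactor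
  rotate (u , f) d w = σ₁₂ u , cubicFactor (ShiftMultipliers-σ₁₂ u (CubicFactor.multipliers f)) d w

  x₁³ x₂³ x₃³ x₁²x₃ x₂²x₁ x₃²x₂ x₁²x₂ x₂²x₃ x₃²x₁ x₁x₂x₃ : Σ XMon CubicFactor
  x₁³    = mon 3 0 0 (+ 0) (+ 0) , cubicFactor multipliers-x₁³ P.refl P.refl
  x₂³    = rotate x₁³ P.refl P.refl
  x₃³    = rotate x₂³ P.refl P.refl
  x₁²x₃  = mon 2 0 1 (+ 0) (+ 2) , cubicFactor multipliers-x₁²x₃ P.refl P.refl
  x₂²x₁  = rotate x₁²x₃ P.refl P.refl
  x₃²x₂  = rotate x₂²x₁ P.refl P.refl
  x₁²x₂  = mon 2 1 0 (+ 0) (+ 1) , cubicFactor multipliers-x₁²x₂ P.refl P.refl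
  x₂²x₃  = rotate x₁²x₂ P.refl P.refl
  x₃²x₁  = rotate x₂²x₃ P.refl P.refl
  x₁x₂x₃ = mon 1 1 1 (+ 0) (+ 0) , cubicFactor multipliers-x₁x₂x₃ P.refl P.refl

  CubicDivisor : XMon → Set (c ⊔ ℓ)
  CubicDivisor m = Σ (Σ XMon CubicFactor) λ u → Σ XMon λ y → m ≡ proj₁ u ·X y

  ·X-split : ∀ u₁ u₂ u₃ β f₁ f₂ f₃ a b →
    (u₁ ℕ.+ f₁ , u₂ ℕ.+ f₂ , u₃ ℕ.+ f₃ , a , b) ≡ mon u₁ u₂ u₃ (+ 0) (+ β) ·X (f₁ , f₂ , f₃ , a , b ℤ.- + β)
  ·X-split u₁ u₂ u₃ β f₁ f₂ f₃ a b =
    P.cong₂ (λ A B → (u₁ ℕ.+ f₁ , u₂ ℕ.+ f₂ , u₃ ℕ.+ f₃ , A , B)) (P.sym (ℤP.+-identityˡ a)) (P.sym (restore (+ β) b))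
    where
    restore : ∀ c b → c ℤ.+ (b ℤ.- c) ≡ b
    restore = solve-∀

  cubic-divisor : ∀ N m → degree m ≡ suc N ℕ.* 3 → CubicDivisor m
  cubic-divisor N (suc (suc (suc f₁)) , e₂ , e₃ , a , b) _ = x₁³ , (f₁ , e₂ , e₃ , a , b ℤ.- + 0) , ·X-split 3 0 0 0 f₁ e₂ e₃ a b
  cubic-divisor N (2 , suc f₂ , e₃ , a , b)              _ = x₁²x₂ , (0 , f₂ , e₃ , a , b ℤ.- + 1) , ·X-split 2 1 0 1 0 f₂ e₃ a b
  cubic-divisor N (2 , 0 , suc f₃ , a , b)               _ = x₁²x₃ , (0 , 0 , f₃ , a , b ℤ.- + 2) , ·X-split 2 0 1 2 0 0 f₃ a b
  cubic-divisor N (1 , suc (suc f₂) , e₃ , a , b)        _ = x₂²x₁ , (0 , f₂ , e₃ , a , b ℤ.- + 2) , ·X-split 1 2 0 2 0 f₂ e₃ a b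
  cubic-divisor N (1 , 1 , suc f₃ , a , b)               _ = x₁x₂x₃ , (0 , 0 , f₃ , a , b ℤ.- + 0) , ·X-split 1 1 1 0 0 0 f₃ a b
  cubic-divisor N (1 , 0 , suc (suc f₃) , a , b)         _ = x₃²x₁ , (0 , 0 , f₃ , a , b ℤ.- + 1) , ·X-split 1 0 2 1 0 0 f₃ a b
  cubic-divisor N (0 , suc (suc (suc f₂)) , e₃ , a , b)  _ = x₂³ , (0 , f₂ , e₃ , a , b ℤ.- + 0) , ·X-split 0 3 0 0 0 f₂ e₃ a b
  cubic-divisor N (0 , 2 , suc f₃ , a , b)               _ = x₂²x₃ , (0 , 0 , f₃ , a , b ℤ.- + 1) , ·X-split 0 2 1 1 0 0 f₃ a b
  cubic-divisor N (0 , 1 , suc (suc f₃) , a , b)         _ = x₃²x₂ , (0 , 0 , f₃ , a , b ℤ.- + 2) , ·X-split 0 1 2 2 0 0 f₃ a b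
  cubic-divisor N (0 , 0 , suc (suc (suc f₃)) , a , b)   _ = x₃³ , (0 , 0 , f₃ , a , b ℤ.- + 0) , ·X-split 0 0 3 0 0 0 f₃ a b
  cubic-divisor N (2 , 0 , 0 , a , b) ()
  cubic-divisor N (1 , 1 , 0 , a , b) ()
  cubic-divisor N (1 , 0 , 1 , a , b) ()
  cubic-divisor N (1 , 0 , 0 , a , b) ()
  cubic-divisor N (0 , 2 , 0 , a , b) ()
  cubic-divisor N (0 , 1 , 1 , a , b) ()
  cubic-divisor N (0 , 1 , 0 , a , b) ()
  cubic-divisor N (0 , 0 , 2 , a , b) ()
  cubic-divisor N (0 , 0 , 1 , a , b) ()
  cubic-divisor N (0 , 0 , 0 , a , b) ()

  χ₂₃-shift : ∀ j y → χ₂₃ (shift j y) ≡ χ₂₃ y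
  χ₂₃-shift j (_ , _ , _ , _ , _) = P.refl

  degree-shift : ∀ j y → degree (shift j y) ≡ degree y
  degree-shift j (_ , _ , _ , _ , _) = P.refl

  InvariantOrbits : ℕ → Set (c ⊔ ℓ)
  InvariantOrbits N = ∀ m → degree m ≡ N ℕ.* 3 → χ₂₃ m ≈ 1# → InImage (orbit m)

  orbit-of-product : ∀ N u y → CubicFactor u → degree (u ·X y) ≡ suc N ℕ.* 3 → χ₂₃ (u ·X y) ≈ 1# →
                     InvariantOrbits N → InImage (orbit (u ·X y))
  orbit-of-product N u y (cubicFactor multipliers degree≡3 weight≡0) deg χ≈1 orbits =
    InImage-≈ᴾ undo-three (InImage-scale t₃ (InImage-≈ᴾ (≈ᴾ-sym (product-formula u y))
      (InImage-concatMap _ (All.map (λ {n} mult → mult _ (orbit-shifted n)) multipliers))))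
    where
    degree-y : degree y ≡ N ℕ.* 3
    degree-y = ℕP.+-cancelˡ-≡ 3 _ _ (P.trans (P.sym (P.cong (ℕ._+ degree y) degree≡3)) (P.trans (P.sym (degree-·X u y)) deg))
    χ₂₃-u : χ₂₃ u ≈ 1#
    χ₂₃-u = trans (χ₂₃≈ζ^weight u) (ζ^-periodic ζ³≈1 (weight u) weight≡0)
    χ₂₃-y : χ₂₃ y ≈ 1#
    χ₂₃-y = trans (sym (*-identityˡ _)) (trans (*-cong (sym χ₂₃-u) refl) (trans (sym (χ₂₃-·X u y)) χ≈1))
    orbit-shifted : ∀ n → InImage (orbit (shift (ℤ.- (+ n)) y))
    orbit-shifted n = orbits (shift (ℤ.- (+ n)) y) (P.trans (degree-shift (ℤ.- (+ n)) y) degree-y)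
                             (trans (reflexive (χ₂₃-shift (ℤ.- (+ n)) y)) χ₂₃-y)
    undo-three : orbit (u ·X y) ≈ᴾ scale t₃ (scale three (orbit (u ·X y)))
    undo-three = ≈ᴾ-sym (≈ᴾ-trans (scale-* t₃ three _) (scale-1 _ t₃*3≈1))

  three≉0 : ¬ three ≈ 0#
  three≉0 3≈0 = 1≉0 (trans (sym t₃*3≈1) (trans (*-cong refl 3≈0) (zeroʳ t₃)))

  orbit-of-constant : ∀ a b → χ₂₃ (mon 0 0 0 a b) ≈ 1# → InImage (orbit (mon 0 0 0 a b))
  orbit-of-constant a b χ≈1 with ζ^-trichotomy ζ³≈1 cubeSum-ζ≈0 b
  ... | inj₂ sum≈0 = ⊥-elim (three≉0 (trans (sym (trans (cubeSum-cong ζ^b≈1) cubeSum-1)) sum≈0))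
    where
    ζ^b≈1 : ζ^ b ≈ 1#
    ζ^b≈1 = trans (sym (trans (*-cong (*-identityʳ 1#) refl) (*-identityˡ _))) χ≈1
  ... | inj₁ (q , P.refl) with ζ^-trichotomy ζ³≈1 cubeSum-ζ≈0 a
  ...   | inj₁ (p , P.refl) = InImage-≈ᴾ
          (≈ᴾ-trans (orbit-of-fixed _ P.refl) (scale-congˡ _ (trans (cubeSum-cong (ζ^[3*q]≈1 ζ³≈1 p)) cubeSum-1)))
          (InImage-scale three (InImage-αβ-cube p q))
  ...   | inj₂ sum≈0 = InImage-≈ᴾ (≈ᴾ-trans (orbit-of-fixed _ P.refl) (scale-0 _ sum≈0)) InImage-[]

  orbit-in-image : ∀ N → InvariantOrbits N
  orbit-in-image zero (zero , zero , zero , a , b) _ χ≈1 = orbit-of-constant a b χ≈1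
  orbit-in-image zero (suc _ , _ , _ , _ , _) ()
  orbit-in-image zero (zero , suc _ , _ , _ , _) ()
  orbit-in-image zero (zero , zero , suc _ , _ , _) ()
  orbit-in-image (suc N) m deg χ≈1 with cubic-divisor N m deg
  ... | (u , factor) , y , P.refl = orbit-of-product N u y factor deg χ≈1 (orbit-in-image N)

module Reynolds {c ℓ} (k : CommutativeRing c ℓ) (ζ : CommutativeRing.Carrier k)
  (ζ³≈1 : CommutativeRing._≈_ k (CommutativeRing._*_ k (CommutativeRing._*_ k ζ ζ) ζ) (CommutativeRing.1# k))
  (cubeSum-ζ≈0 : CommutativeRing._≈_ k (CubeRoot.cubeSum k ζ ζ) (CommutativeRing.0# k))
  (1≉0 : ¬ CommutativeRing._≈_ k (CommutativeRing.1# k) (CommutativeRing.0# k))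
  (t₃ : CommutativeRing.Carrier k)
  (t₃*3≈1 : CommutativeRing._≈_ k (CommutativeRing._*_ k t₃ (ProductFormula.three k ζ ζ³≈1 cubeSum-ζ≈0)) (CommutativeRing.1# k)) where
  open CommutativeRing k
  open Setup k ζ
  open Pairing k ζ
  open CubeRoot k ζ
  open HeisenbergAction k ζ ζ³≈1
  open Orbits k ζ ζ³≈1
  open ImageClosure k ζ
  open ProductFormula k ζ ζ³≈1 cubeSum-ζ≈0
  open OrbitsInImage k ζ ζ³≈1 cubeSum-ζ≈0 1≉0 t₃ t₃*3≈1
  open import Algebra.Solver.Ring.NaturalCoefficients.Default commutativeSemiring

  elements : List H
  elements = concatMap (λ a → concatMap (λ b → map (λ c → a , b , c) I₃) I₃) I₃

  ∑-elements : ∀ F → ∑ elements F ≈ ∑ I₃ (λ a → ∑ I₃ (λ b → ∑ I₃ (λ c → F (a , b , c))))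
  ∑-elements F = trans (∑-concatMap (λ a → concatMap (λ b → map (λ c → a , b , c) I₃) I₃) I₃ F) (∑-cong I₃ (λ a →
    trans (∑-concatMap (λ b → map (λ c → a , b , c) I₃) I₃ F) (∑-cong I₃ (λ b → reflexive (∑-map (λ c → a , b , c) I₃ F)))))

  -- As c runs through ℤ/3, so does the exponent (c + d) mod 3 of E₁₃ in act (a , b , c).
  ∑-rotated-powers : ∀ x d → ∑ I₃ (λ c → x ^ ((toℕ c ℕ.+ d) ℕ.% 3)) ≈ cubeSum x
  ∑-rotated-powers x d = trans (∑-cong I₃ (λ c → reflexive (P.cong (x ^_) (reduce c))))
                               (by-residue (d ℕ.% 3) (ℕD.m%n<n d 3))
    where
    reduce : ∀ (c : Fin 3) → (toℕ c ℕ.+ d) ℕ.% 3 ≡ (toℕ c ℕ.+ d ℕ.% 3) ℕ.% 3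
    reduce c = P.trans (ℕD.%-distribˡ-+ (toℕ c) d 3) (P.cong (λ r → (r ℕ.+ d ℕ.% 3) ℕ.% 3) (ℕD.m<n⇒m%n≡m (toℕ<n c)))
    by-residue : ∀ r → r ℕ.< 3 → ∑ I₃ (λ c → x ^ ((toℕ c ℕ.+ r) ℕ.% 3)) ≈ cubeSum x
    by-residue 0 _ = solve 1 (λ x → con 1 :+ (x :* con 1 :+ (x :* (x :* con 1) :+ con 0)) := con 1 :+ x :+ x :* x) refl x
    by-residue 1 _ = solve 1 (λ x → x :* con 1 :+ (x :* (x :* con 1) :+ (con 1 :+ con 0)) := con 1 :+ x :+ x :* x) refl x
    by-residue 2 _ = solve 1 (λ x → x :* (x :* con 1) :+ (con 1 :+ (x :* con 1 :+ con 0)) := con 1 :+ x :+ x :* x) refl x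
    by-residue (suc (suc (suc _))) (ℕ.s≤s (ℕ.s≤s (ℕ.s≤s ())))

  ∑-powers : ∀ x z → ∑ I₃ (λ b → x ^ toℕ b * z) ≈ cubeSum x * z
  ∑-powers x z = solve 2 (λ x z → con 1 :* z :+ (x :* con 1 :* z :+ (x :* (x :* con 1) :* z :+ con 0))
                                := (con 1 :+ x :+ x :* x) :* z) refl x z

  ∑-E₁₂-orbit : ∀ m h → ∑ I₃ (λ a → E₁₂.iterT (toℕ a) h m) ≈ ⟪ orbit m ⟫ h
  ∑-E₁₂-orbit m@(_ , _ , _ , _ , _) h = solve 4 (λ u h₀ h₁ h₂ → h₀ :+ (u :* h₁ :+ (u :* (u :* h₂) :+ con 0))
                                                    := con 1 :* h₀ :+ (u :* h₁ :+ (u :* u :* h₂ :+ con 0))) refl _ _ _ _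

  K : XMon → Carrier
  K m = cubeSum (χ₁₃ m) * cubeSum (χ₂₃ m)

  T[g]-factors : ∀ a b c h m → T[ (a , b , c) ] h m ≈
                 χ₁₃ m ^ exponent₁₃ (a , b , c) * (χ₂₃ m ^ toℕ b * E₁₂.iterT (toℕ a) h m)
  T[g]-factors a b c h m = trans (E₁₃.iterT-diagonal (λ _ → P.refl) (exponent₁₃ (a , b , c)) _ m)
                                 (*-cong refl (E₂₃.iterT-diagonal (λ _ → P.refl) (toℕ b) _ m))

  ∑-T[g] : ∀ m h → ∑ elements (λ g → T[ g ] h m) ≈ K m * ⟪ orbit m ⟫ h
  ∑-T[g] m h = begin
    ∑ elements (λ g → T[ g ] h m)
      ≈⟨ ∑-elements (λ g → T[ g ] h m) ⟩
    ∑ I₃ (λ a → ∑ I₃ (λ b → ∑ I₃ (λ c → T[ (a , b , c) ] h m)))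
      ≈⟨ ∑-cong I₃ (λ a → ∑-cong I₃ (λ b → trans (∑-cong I₃ (λ c → T[g]-factors a b c h m))
                                                (trans (∑-*ʳ I₃ (λ c → χ₁₃ m ^ exponent₁₃ (a , b , c)) (χ₂₃ m ^ toℕ b * Y a))
                                                       (*-cong (∑-rotated-powers (χ₁₃ m) (2 ℕ.* toℕ a ℕ.* toℕ b)) refl)))) ⟩
    ∑ I₃ (λ a → ∑ I₃ (λ b → cubeSum (χ₁₃ m) * (χ₂₃ m ^ toℕ b * Y a)))
      ≈⟨ ∑-cong I₃ (λ a → trans (∑-*ˡ I₃ (cubeSum (χ₁₃ m)) (λ b → χ₂₃ m ^ toℕ b * Y a)) (*-cong refl (∑-powers (χ₂₃ m) (Y a)))) ⟩
    ∑ I₃ (λ a → cubeSum (χ₁₃ m) * (cubeSum (χ₂₃ m) * Y a))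
      ≈⟨ ∑-cong I₃ (λ a → sym (*-assoc (cubeSum (χ₁₃ m)) (cubeSum (χ₂₃ m)) (Y a))) ⟩
    ∑ I₃ (λ a → K m * Y a)
      ≈⟨ ∑-*ˡ I₃ (K m) Y ⟩
    K m * ∑ I₃ Y
      ≈⟨ *-cong refl (∑-E₁₂-orbit m h) ⟩
    K m * ⟪ orbit m ⟫ h ∎
    where
    open ≈-Reasoning
    Y : Fin 3 → Carrier
    Y a = E₁₂.iterT (toℕ a) h m

  average : LPoly → LPoly
  average = concatMap (λ t → scale (proj₁ t) (scale (K (proj₂ t)) (orbit (proj₂ t))))

  ∑-act : ∀ f h → ∑ elements (λ g → ⟪ act g f ⟫ h) ≈ ⟪ average f ⟫ h
  ∑-act f h = begin
    ∑ elements (λ g → ⟪ act g f ⟫ h)              ≈⟨ ∑-cong elements (λ g → ⟪act⟫ g f h) ⟩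
    ∑ elements (λ g → ⟪ f ⟫ (T[ g ] h))           ≈⟨ ⟪⟫-∑ elements f (λ g → T[ g ] h) ⟩
    ⟪ f ⟫ (λ m → ∑ elements (λ g → T[ g ] h m))   ≈⟨ ⟪⟫-cong f (λ m → ∑-T[g] m h) ⟩
    ⟪ f ⟫ (λ m → K m * ⟪ orbit m ⟫ h)             ≈⟨ ∑-cong f (λ t → *-cong refl (sym (⟪scale⟫ (K (proj₂ t)) (orbit (proj₂ t)) h))) ⟩
    ∑ f (λ t → proj₁ t * ⟪ scale (K (proj₂ t)) (orbit (proj₂ t)) ⟫ h)
      ≈⟨ sym (trans (∑-concatMap _ f _) (∑-cong f (λ t → ⟪scale⟫ (proj₁ t) (scale (K (proj₂ t)) (orbit (proj₂ t))) h))) ⟩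
    ⟪ average f ⟫ h ∎
    where open ≈-Reasoning

  averaged-in-image : ∀ m → InImage (scale (K m) (orbit m))
  averaged-in-image m with ζ^ℕ-trichotomy ζ³≈1 cubeSum-ζ≈0 (degree m)
  ... | inj₂ sum≈0 = InImage-≈ᴾ (scale-0 _ (trans (*-cong sum≈0 refl) (zeroˡ _))) InImage-[]
  ... | inj₁ (N , degree≡) with ζ^-trichotomy ζ³≈1 cubeSum-ζ≈0 (weight m)
  ...   | inj₂ sum≈0 = InImage-≈ᴾ
          (scale-0 _ (trans (*-cong refl (trans (cubeSum-cong (χ₂₃≈ζ^weight m)) sum≈0)) (zeroʳ _))) InImage-[]
  ...   | inj₁ (q , weight≡) = InImage-scale (K m) (orbit-in-image N m degree≡
          (trans (χ₂₃≈ζ^weight m) (trans (reflexive (P.cong ζ^ weight≡)) (ζ^[3*q]≈1 ζ³≈1 q))))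

  open import Algebra.Properties.Monoid.Mult +-monoid using (_×_; ×-assocˡ; ×-congʳ)

  three× : ∀ u → 3 × u ≈ three * u
  three× u = solve 1 (λ u → u :+ (u :+ (u :+ con 0)) := (con 1 :+ con 1 :+ con 1) :* u) refl u

  twenty-seven× : ∀ u → 27 × u ≈ three * (three * (three * u))
  twenty-seven× u = begin
    27 × u               ≈⟨ sym (×-assocˡ u 3 9) ⟩
    3 × (9 × u)          ≈⟨ ×-congʳ 3 (sym (×-assocˡ u 3 3)) ⟩
    3 × (3 × (3 × u))    ≈⟨ trans (×-congʳ 3 (×-congʳ 3 (three× u))) (trans (×-congʳ 3 (three× _)) (three× _)) ⟩
    three * (three * (three * u)) ∎
    where open ≈-Reasoning

  divide-by-three : ∀ {x y} → three * x ≈ y → x ≈ t₃ * y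
  divide-by-three {x} {y} 3x≈y = begin
    x                   ≈⟨ sym (trans (*-cong t₃*3≈1 refl) (*-identityˡ x)) ⟩
    (t₃ * three) * x    ≈⟨ *-assoc t₃ three x ⟩
    t₃ * (three * x)    ≈⟨ *-cong refl 3x≈y ⟩
    t₃ * y ∎
    where open ≈-Reasoning

  invariant⇒image : ∀ f → Invariant f → Image f
  invariant⇒image f invariant = proj₁ average-in-image , λ m → sym (≈ᴾ⇒≋ f≈θP m)
    where
    average-in-image : InImage (scale t₃ (scale t₃ (scale t₃ (average f))))
    average-in-image = InImage-scale t₃ (InImage-scale t₃ (InImage-scale t₃
      (InImage-concatMap _ (All.universal (λ t → InImage-scale (proj₁ t) (averaged-in-image (proj₂ t))) f))))
    twenty-seven-f : ∀ h → three * (three * (three * ⟪ f ⟫ h)) ≈ ⟪ average f ⟫ h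
    twenty-seven-f h = begin
      three * (three * (three * ⟪ f ⟫ h))   ≈⟨ sym (twenty-seven× _) ⟩
      length elements × ⟪ f ⟫ h             ≈⟨ sym (∑-const elements _) ⟩
      ∑ elements (λ _ → ⟪ f ⟫ h)            ≈⟨ ∑-cong elements (λ g → sym (pointwise (≋⇒≈ᴾ {act g f} {f} (invariant g)) h)) ⟩
      ∑ elements (λ g → ⟪ act g f ⟫ h)      ≈⟨ ∑-act f h ⟩
      ⟪ average f ⟫ h ∎
      where open ≈-Reasoning
    f≈average : f ≈ᴾ scale t₃ (scale t₃ (scale t₃ (average f)))
    pointwise f≈average h = begin
      ⟪ f ⟫ h                                            ≈⟨ divide-by-three (divide-by-three (divide-by-three (twenty-seven-f h))) ⟩
      t₃ * (t₃ * (t₃ * ⟪ average f ⟫ h))                 ≈⟨ *-cong refl (*-cong refl (sym (⟪scale⟫ t₃ (average f) h))) ⟩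
      t₃ * (t₃ * ⟪ scale t₃ (average f) ⟫ h)             ≈⟨ *-cong refl (sym (⟪scale⟫ t₃ (scale t₃ (average f)) h)) ⟩
      t₃ * ⟪ scale t₃ (scale t₃ (average f)) ⟫ h         ≈⟨ sym (⟪scale⟫ t₃ (scale t₃ (scale t₃ (average f))) h) ⟩
      ⟪ scale t₃ (scale t₃ (scale t₃ (average f))) ⟫ h ∎
      where open ≈-Reasoning
    f≈θP : f ≈ᴾ θ (proj₁ average-in-image)
    f≈θP = ≈ᴾ-trans f≈average (proj₂ average-in-image)

module FieldFacts {c ℓ} (k : CommutativeRing c ℓ) where
  open CommutativeRing k
  open import Algebra.Properties.Monoid.Mult +-monoid using (_×_)
  open import Algebra.Properties.Monoid.Mult ℚP.+-0-monoid using () renaming (_×_ to _×ℚ_)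
  open import Algebra.Properties.Ring ring using (-‿distribʳ-*)
  open import Algebra.Properties.Group +-group using (x∙y⁻¹≈ε⇒x≈y)
  open import Relation.Binary.Reasoning.Setoid setoid
  open import Algebra.Solver.Ring.NaturalCoefficients.Default commutativeSemiring

  module _ (φ : ℚ → Carrier)
           (φ-hom : RingMorphisms.IsRingHomomorphism (CommutativeRing.rawRing ℚP.+-*-commutativeRing) rawRing φ) where
    open RingMorphisms.IsRingHomomorphism φ-hom

    φ-× : ∀ n → φ (n ×ℚ ℚ.1ℚ) ≈ n × 1#
    φ-× zero    = 0#-homo
    φ-× (suc n) = trans (+-homo ℚ.1ℚ (n ×ℚ ℚ.1ℚ)) (+-cong 1#-homo (φ-× n))

    φ-inverse : ∀ q n → q ℚ.* (n ×ℚ ℚ.1ℚ) ≡ ℚ.1ℚ → φ q * (n × 1#) ≈ 1#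
    φ-inverse q n q*n≡1 = begin
      φ q * (n × 1#)          ≈⟨ *-cong refl (sym (φ-× n)) ⟩
      φ q * φ (n ×ℚ ℚ.1ℚ)     ≈⟨ sym (*-homo q (n ×ℚ ℚ.1ℚ)) ⟩
      φ (q ℚ.* (n ×ℚ ℚ.1ℚ))   ≡⟨ P.cong φ q*n≡1 ⟩
      φ ℚ.1ℚ                  ≈⟨ 1#-homo ⟩
      1# ∎

    φ⅓*3≈1 : φ (+ 1 ℚ./ 3) * (1# + 1# + 1#) ≈ 1#
    φ⅓*3≈1 = trans (*-cong refl (solve 0 (con 1 :+ con 1 :+ con 1 := con 1 :+ (con 1 :+ (con 1 :+ con 0))) refl))
                  (φ-inverse (+ 1 ℚ./ 3) 3 P.refl)

  -- Multiplying by ζ fixes 1 + ζ + ζ², while ζ - 1 is invertible.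
  cubeSum-primitive≈0 : ∀ ζ → IsField k → ζ * ζ * ζ ≈ 1# → ¬ ζ ≈ 1# → CubeRoot.cubeSum k ζ ζ ≈ 0#
  cubeSum-primitive≈0 ζ (_ , inverse) ζ³≈1 ζ≉1 with inverse (ζ - 1#) (λ ζ-1≈0 → ζ≉1 (x∙y⁻¹≈ε⇒x≈y ζ 1# ζ-1≈0))
  ... | y , [ζ-1]y≈1 = begin
    s                       ≈⟨ sym (*-identityʳ s) ⟩
    s * 1#                  ≈⟨ *-cong refl (sym [ζ-1]y≈1) ⟩
    s * ((ζ - 1#) * y)      ≈⟨ sym (*-assoc _ _ _) ⟩
    (s * (ζ - 1#)) * y      ≈⟨ *-cong s[ζ-1]≈0 refl ⟩
    0# * y                  ≈⟨ zeroˡ y ⟩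
    0# ∎
    where
    s : Carrier
    s = 1# + ζ + ζ * ζ
    sζ≈s : s * ζ ≈ s
    sζ≈s = trans (solve 1 (λ z → (con 1 :+ z :+ z :* z) :* z := z :* z :* z :+ z :+ z :* z) refl ζ)
                 (+-cong (+-cong ζ³≈1 refl) refl)
    s[ζ-1]≈0 : s * (ζ - 1#) ≈ 0#
    s[ζ-1]≈0 = trans (distribˡ s ζ (- 1#))
      (trans (+-cong sζ≈s (trans (sym (-‿distribʳ-* s 1#)) (-‿cong (*-identityʳ s)))) (-‿inverseʳ s))

-- Only the field axioms and the embedding of ℚ (to invert 3) are used.
mainTheorem2 : ∀ {c ℓ : Level} (k : CommutativeRing c ℓ) → IsNumberField k →
    (ζ : CommutativeRing.Carrier k) → IsPrimitiveCubeRoot k ζ →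
    (f : Setup.LPoly k ζ) → Setup.Image k ζ f ⇔ Setup.Invariant k ζ f
mainTheorem2 k (isField , φ , φ-hom , _) ζ (ζ³≈1 , ζ≉1) f =
  mk⇔ (Orbits.image⇒invariant k ζ ζ³≈1 f)
      (Reynolds.invariant⇒image k ζ ζ³≈1 (cubeSum-primitive≈0 ζ isField ζ³≈1 ζ≉1) (proj₁ isField)
                                (φ (+ 1 ℚ./ 3)) (φ⅓*3≈1 φ φ-hom) f)
  where open FieldFacts k
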